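{- There is an infinite family of $3$-connected planar graphs with maximum degree $4$, girth $4$ and injective chromatic number $6$.
   Context: All graphs are simple. The girth is the length of a shortest cycle. An injective $k$-colouring of $G$ is a map $c:V(G)\to\{1,\dots,k\}$ such that any two distinct vertices with a common neighbour get different colours; the injective chromatic number $\chi_i(G)$ is the least such $k$. -}

module Defs where

open import Data.Nat using (ℕ; zero; suc; _+_; _*_; _≤_; _<_)
open import Data.Fin using (Fin; toℕ) renaming (zero to fz; suc to fs)
open import Data.Bool using (Bool; true; false; _∧_; T; if_then_else_)
open import Data.Product using (Σ; ∃; _×_; _,_)
open import Relation.Binary.PropositionalEquality using (_≡_; _≢_)
open import Relation.Nullary using (¬_)
open import Function using (_∘_)

record Graph (n : ℕ) : Set where
  field
    adj   : Fin n → Fin n → Bool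
    sym   : ∀ u v → adj u v ≡ adj v u
    irref : ∀ v → adj v v ≡ false
open Graph public

module _ {n : ℕ} (G : Graph n) where

  _~_ : Fin n → Fin n → Set
  u ~ v = T (adj G u v)

sumF : ∀ {n} → (Fin n → ℕ) → ℕ
sumF {zero}  f = 0
sumF {suc n} f = f fz + sumF (f ∘ fs)

count : ∀ {n} → (Fin n → Bool) → ℕ
count {zero}  p = 0
count {suc n} p = (if p fz then 1 else 0) + count (p ∘ fs)

degree : ∀ {n} → Graph n → Fin n → ℕ
degree G v = count (adj G v)

MaxDegree : ∀ {n} → Graph n → ℕ → Set
MaxDegree {n} G d = (∀ v → degree G v ≤ d) × (∃ λ v → degree G v ≡ d)

next : ∀ {k} → Fin k → Fin k
next {suc k} i with toℕ i Data.Nat.<? k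
... | Relation.Nullary.yes p = Data.Fin.fromℕ< (Data.Nat.s≤s p)
... | Relation.Nullary.no _  = fz

HasCycle : ∀ {n} → Graph n → ℕ → Set
HasCycle {n} G k = 3 ≤ k × Σ (Fin k → Fin n) λ f →
  (∀ i j → f i ≡ f j → i ≡ j) × (∀ i → _~_ G (f i) (f (next i)))

Girth : ∀ {n} → Graph n → ℕ → Set
Girth G g = HasCycle G g × (∀ k → k < g → ¬ HasCycle G k)

data Reach {n} (G : Graph n) (ok : Fin n → Set) : Fin n → Fin n → Set where
  here : ∀ {u} → Reach G ok u u
  step : ∀ {u w v} → _~_ G u w → ok w → Reach G ok w v → Reach G ok u v

-- k-connected for k = 3: more than 3 vertices, and deleting any set of
-- at most 2 vertices {a , b} (a = b allowed) leaves a connected graph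
ThreeConnected : ∀ {n} → Graph n → Set
ThreeConnected {n} G = 4 ≤ n ×
  (∀ (a b u v : Fin n) → u ≢ a → u ≢ b → v ≢ a → v ≢ b →
     Reach G (λ w → w ≢ a × w ≢ b) u v)

InjectiveColouring : ∀ {n} → Graph n → (k : ℕ) → (Fin n → Fin k) → Set
InjectiveColouring {n} G k c =
  ∀ u v w → u ≢ v → _~_ G u w → _~_ G v w → c u ≢ c v

InjChromatic : ∀ {n} → Graph n → ℕ → Set
InjChromatic {n} G k =
  (Σ (Fin n → Fin k) (InjectiveColouring G k)) ×
  (∀ j → j < k → ¬ Σ (Fin n → Fin j) (InjectiveColouring G j))

-- Faces are the orbits of the dart map
-- φ (u , v) = (v , σ v u) on darts (ordered pairs of adjacent vertices).
-- A connected graph with at least one edge is planar iff it has a rotation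
-- system of Euler genus 0, i.e.  |V| - |E| + |F| = 2,
-- equivalently 2|V| + 2|F| = |D| + 4 (|D| = 2|E| darts).

iter : ∀ {A : Set} → ℕ → (A → A) → A → A
iter zero    f x = x
iter (suc k) f x = f (iter k f x)

record Rotation {n} (G : Graph n) : Set where
  field
    σ      : Fin n → Fin n → Fin n
    closed : ∀ v u → _~_ G v u → _~_ G v (σ v u)
    inj    : ∀ v u w → _~_ G v u → _~_ G v w → σ v u ≡ σ v w → u ≡ w
    cyclic : ∀ v u w → _~_ G v u → _~_ G v w → ∃ λ k → iter k (σ v) u ≡ w
open Rotation public

Dart : ℕ → Set
Dart n = Fin n × Fin n

faceStep : ∀ {n} {G : Graph n} → Rotation G → Dart n → Dart n
faceStep R (u , v) = (v , σ R v u)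

rank : ∀ {n} → Dart n → ℕ
rank {n} (u , v) = toℕ u * n + toℕ v

allBelow : ℕ → (ℕ → Bool) → Bool
allBelow zero    p = true
allBelow (suc k) p = p k ∧ allBelow k p

-- d is the rank-minimal dart of its face (φ-orbit); orbits have size ≤ n*n
isFaceRep : ∀ {n} {G : Graph n} → Rotation G → Dart n → Bool
isFaceRep {n} R d = allBelow (n * n)
  (λ k → rank d Data.Nat.≤ᵇ rank (iter k (faceStep R) d))

numFaces : ∀ {n} {G : Graph n} → Rotation G → ℕ
numFaces {n} {G} R =
  sumF (λ u → count (λ v → adj G u v ∧ isFaceRep R (u , v)))

numDarts : ∀ {n} → Graph n → ℕ
numDarts G = sumF (λ u → degree G u)

Planar : ∀ {n} → Graph n → Set
Planar {n} G = Σ (Rotation G) λ R → 2 * n + 2 * numFaces R ≡ numDarts G + 4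

{-# OPTIONS --safe #-}
-- G_N is a chain of N + 2 blocks between a source and a sink. Block i has an inner, a centre and
-- an outer vertex of each residue k mod 3; the centres form a 6-cycle with the inner vertices and
-- another with the outer ones, the outer vertices of block i are matched to the inner vertices of
-- block i + 1, and the source (sink) sees the inner (outer) vertices of the first (last) block.
-- All degrees are 4 except for eight vertices of degree 3 at the two ends.
--
-- Planarity: read the neighbour lists as a rotation system; every face is a quadrilateral, and
-- with 2|E| = 4|V| - 8 Euler's formula holds. Girth: the graph is bipartite and has 4-cycles.
-- Injective chromatic number: the six inner and outer vertices of the first block pairwise share
-- a centre; six colours suffice, colouring a vertex by its residue and by a bit depending on its
-- layer and on the block index mod 4. 3-connectivity: the block vertices form three disjoint
-- source-sink paths (tracks) with edges between any two of them. Deleting two vertices leaves a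
-- whole track; every other vertex reaches it along its own track through the source or the sink,
-- or, when both ways are blocked, across to another track, which is then intact as well.

module Submission where

open import Defs hiding (sym; closed; inj; cyclic)
open import Data.Bool using (Bool; true; false; _∧_; _∨_; not; T; if_then_else_)
open import Data.Bool.Properties using (not-¬; not-involutive; T-∧)
open import Data.Empty using (⊥-elim)
open import Data.Fin as Fin using (Fin; toℕ; _↑ˡ_; _↑ʳ_; combine; remQuot; splitAt; join) renaming (zero to fz; suc to fs)
open import Data.Fin.Patterns using (0F; 1F; 2F; 3F; 4F; 5F)
open import Data.Fin.Properties using (all?; any?; pigeonhole; toℕ≤pred[n]; toℕ-injective; toℕ-combine; combine-injective; suc-injective; join-splitAt; splitAt-↑ʳ; remQuot-combine; combine-remQuot)
open import Data.List using (List; []; _∷_; map; _∷ʳ_; _++_; length; lookup)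
open import Data.List.Membership.Propositional using (_∈_; _∉_)
open import Data.List.Membership.Propositional.Properties using (∈-lookup; ∈-map⁺)
open import Data.List.Properties using (map-++; map-∘; ∷-injectiveˡ; ∷-injectiveʳ)
open import Data.List.Relation.Unary.All as All using (All; []; _∷_)
open import Data.List.Relation.Unary.AllPairs using ([]; _∷_)
open import Data.List.Relation.Unary.Any using (here; there)
open import Data.List.Relation.Unary.Unique.Propositional using (Unique)
open import Data.List.Relation.Unary.Unique.DecPropositional (Fin._≟_ {6}) using (unique?)
open import Data.Maybe using (Maybe; just; nothing; is-nothing)
open import Data.Maybe.Properties using (just-injective)
open import Data.Nat as ℕ using (ℕ; zero; suc; pred; _+_; _*_; _≤_; _<_; _∸_; z≤n; s≤s; s≤s⁻¹)
open import Data.Nat.ListAction using (sum)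
open import Data.Nat.ListAction.Properties using (sum-++)
open import Data.Nat.Properties using (+-assoc; +-comm; +-identityʳ; +-suc; *-comm; *-zeroʳ; *-identityʳ; *-distribˡ-+; *-cancelˡ-≡; +-mono-≤; *-monoˡ-≤; +-∸-assoc; m∸n≤m; m∸n+n≡m; m+[n∸m]≡n; m+n∸m≡n; n∸n≡0; m≤m+n; m≤n+m; m≤m*n; m+n≤o⇒m≤o; n≤1+n; m≤n⇒m≤1+n; ≤-refl; ≤-reflexive; ≤-trans; ≤-antisym; <⇒≤; ≰⇒>; ≤∧≢⇒<; <-cmp; <-asym; ≤ᵇ⇒≤; ≤⇒≤ᵇ; module ≤-Reasoning)
open import Data.Nat.Solver using (module +-*-Solver)
open import Data.Product using (Σ; ∃; ∃₂; _×_; _,_; proj₁; proj₂)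
open import Data.Sum using (_⊎_; inj₁; inj₂; [_,_]′)
open import Data.Unit using (⊤)
open import Function using (_∘_)
open import Function.Bundles using (_⇔_; mk⇔; Equivalence)
open import Relation.Binary.Definitions using (DecidableEquality; tri<; tri≈; tri>)
open import Relation.Binary.PropositionalEquality using (_≡_; _≢_; ≢-sym; refl; sym; trans; cong; cong₂; subst; subst₂; module ≡-Reasoning)
open import Relation.Nullary using (¬_; Dec; yes; no; does)
open import Relation.Nullary.Decidable using (True; map′; dec-true; dec-false; does-⇔; toWitness; _×-dec_; _⊎-dec_; _→-dec_; ¬?)

open +-*-Solver using (solve; _:+_; _:*_; _:=_; con)

indicator : Bool → ℕ
indicator b = if b then 1 else 0

sumF-cong : ∀ {n} {f g : Fin n → ℕ} → (∀ i → f i ≡ g i) → sumF f ≡ sumF g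
sumF-cong {zero}  f≗g = refl
sumF-cong {suc n} f≗g = cong₂ _+_ (f≗g fz) (sumF-cong (f≗g ∘ fs))

sumF-+ : ∀ {n} (f g : Fin n → ℕ) → sumF (λ i → f i + g i) ≡ sumF f + sumF g
sumF-+ {zero}  f g = refl
sumF-+ {suc n} f g = trans (cong (f fz + g fz +_) (sumF-+ (f ∘ fs) (g ∘ fs)))
  (solve 4 (λ a b c d → (a :+ b) :+ (c :+ d) := (a :+ c) :+ (b :+ d)) refl (f fz) (g fz) _ _)

sumF-const : ∀ n c → sumF {n} (λ _ → c) ≡ n * c
sumF-const zero    c = refl
sumF-const (suc n) c = cong (c +_) (sumF-const n c)

sumF-0 : ∀ n → sumF {n} (λ _ → 0) ≡ 0
sumF-0 n = trans (sumF-const n 0) (*-zeroʳ n)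

*-sumF : ∀ {n} a (f : Fin n → ℕ) → a * sumF f ≡ sumF (λ i → a * f i)
*-sumF {zero}  a f = *-zeroʳ a
*-sumF {suc n} a f = trans (*-distribˡ-+ a (f fz) (sumF f′)) (cong (a * f fz +_) (*-sumF a f′))
  where f′ = f ∘ fs

sumF-comm : ∀ {m n} (f : Fin m → Fin n → ℕ) →
            sumF (λ i → sumF (f i)) ≡ sumF (λ j → sumF (λ i → f i j))
sumF-comm {zero}  {n} f = sym (sumF-0 n)
sumF-comm {suc m} {n} f = trans (cong (sumF (f fz) +_) (sumF-comm (f ∘ fs)))
  (sym (sumF-+ (f fz) (λ j → sumF (λ i → f (fs i) j))))

sumF-↑ : ∀ m {n} (f : Fin (m + n) → ℕ) → sumF f ≡ sumF (f ∘ (_↑ˡ n)) + sumF (f ∘ (m ↑ʳ_))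
sumF-↑ zero    f = refl
sumF-↑ (suc m) f = trans (cong (f fz +_) (sumF-↑ m (f ∘ fs))) (sym (+-assoc (f fz) _ _))

sumF-combine : ∀ m n (f : Fin (m * n) → ℕ) → sumF f ≡ sumF {m} (λ b → sumF {n} (λ p → f (combine b p)))
sumF-combine zero    n f = refl
sumF-combine (suc m) n f = trans (sumF-↑ n f)
  (cong (sumF {n} (λ p → f (combine {suc m} fz p)) +_) (sumF-combine m n (f ∘ (n ↑ʳ_))))

sumF-δ : ∀ {n} (a : Fin n) (f : Fin n → ℕ) → sumF (λ u → indicator (does (u Fin.≟ a)) * f u) ≡ f a
sumF-δ {suc n} fz     f = trans (cong (f fz + 0 +_) (sumF-0 n)) (trans (+-identityʳ _) (+-identityʳ _))
sumF-δ {suc n} (fs a) f = sumF-δ a (f ∘ fs)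

count-sumF : ∀ {n} (p : Fin n → Bool) → count p ≡ sumF (indicator ∘ p)
count-sumF {zero}  p = refl
count-sumF {suc n} p = cong (indicator (p fz) +_) (count-sumF (p ∘ fs))

indicator-∧ : ∀ a b → indicator (a ∧ b) ≡ indicator a * indicator b
indicator-∧ false b = refl
indicator-∧ true  b = sym (+-identityʳ (indicator b))

indicator-∨ : ∀ a b x → ¬ (T a × T b) → indicator (a ∨ b) * x ≡ indicator a * x + indicator b * x
indicator-∨ false b     x _    = refl
indicator-∨ true  false x _    = sym (+-identityʳ _)
indicator-∨ true  true  x both = ⊥-elim (both (_ , _))

sumF-indicator-unique : ∀ {k} (p : Fin k → Bool) → (∀ s t → T (p s) → T (p t) → s ≡ t) →
                        ∃ (T ∘ p) → sumF (indicator ∘ p) ≡ 1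
sumF-indicator-unique {suc k} p unique (s , ps) with p fz in p0
... | true  = cong suc (trans (sumF-cong none) (sumF-0 k))
  where
  none : ∀ t → indicator (p (fs t)) ≡ 0
  none t with p (fs t) in pt
  ... | false = refl
  ... | true  with unique fz (fs t) (subst T (sym p0) _) (subst T (sym pt) _)
  ...   | ()
... | false with s
...   | fz   = ⊥-elim (subst T p0 ps)
...   | fs s′ = sumF-indicator-unique (p ∘ fs) (λ s t ps pt → suc-injective (unique (fs s) (fs t) ps pt)) (s′ , ps)

does-witness : ∀ {P : Set} (p? : Dec P) → T (does p?) → P
does-witness (yes p) _ = p

sum-map-cong : ∀ {A : Set} {f g : A → ℕ} (L : List A) → (∀ {y} → y ∈ L → f y ≡ g y) → sum (map f L) ≡ sum (map g L)
sum-map-cong []      f≗g = refl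
sum-map-cong (y ∷ L) f≗g = cong₂ _+_ (f≗g (here refl)) (sum-map-cong L (f≗g ∘ there))

sum-map-1 : ∀ {A : Set} (L : List A) → sum (map (λ _ → 1) L) ≡ length L
sum-map-1 []      = refl
sum-map-1 (_ ∷ L) = cong suc (sum-map-1 L)

map-≡-∈ : ∀ {A B : Set} {f g : A → B} {y} L → map f L ≡ map g L → y ∈ L → f y ≡ g y
map-≡-∈ (_ ∷ _) eq (here refl) = ∷-injectiveˡ eq
map-≡-∈ (_ ∷ L) eq (there y∈) = map-≡-∈ L (∷-injectiveʳ eq) y∈

lookup-injective : ∀ {A : Set} {xs : List A} → Unique xs → ∀ i j → lookup xs i ≡ lookup xs j → i ≡ j
lookup-injective (_ ∷ _)      fz     fz     _  = refl
lookup-injective (x∉ ∷ _)     fz     (fs j) eq = ⊥-elim (All.lookup x∉ (∈-lookup j) eq)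
lookup-injective (x∉ ∷ _)     (fs i) fz     eq = ⊥-elim (All.lookup x∉ (∈-lookup i) (sym eq))
lookup-injective (_ ∷ unique) (fs i) (fs j) eq = cong fs (lookup-injective unique i j eq)

unique-map-≢ : ∀ {A B : Set} (f : A → B) {L x y} → Unique (map f L) → x ∈ L → y ∈ L → x ≢ y → f x ≢ f y
unique-map-≢ f _               (here refl) (here refl) x≢y = ⊥-elim (x≢y refl)
unique-map-≢ f (fz∉ ∷ _)      (here refl) (there y∈)  _   = All.lookup fz∉ (∈-map⁺ f y∈)
unique-map-≢ f (fz∉ ∷ _)      (there x∈)  (here refl) _   = λ eq → All.lookup fz∉ (∈-map⁺ f x∈) (sym eq)
unique-map-≢ f (_ ∷ unique)   (there x∈)  (there y∈)  x≢y = unique-map-≢ f unique x∈ y∈ x≢y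

module Encoding {n} {V : Set} (_≟_ : DecidableEquality V) (vertex : Fin n → V) (index : V → Fin n)
                (index-vertex : ∀ u → index (vertex u) ≡ u) where

  open import Data.List.Membership.DecPropositional _≟_ using (_∈?_)

  sumF-∈ : ∀ L → Unique L → (∀ {y} → y ∈ L → vertex (index y) ≡ y) → ∀ (f : Fin n → ℕ) →
           sumF (λ u → indicator (does (vertex u ∈? L)) * f u) ≡ sum (map (f ∘ index) L)
  sumF-∈ []      _              _      f = sumF-0 n
  sumF-∈ (y ∷ L) (y∉L ∷ unique) decode f = begin
    sumF (λ u → indicator (does (vertex u ∈? y ∷ L)) * f u)
      ≡⟨ sumF-cong (λ u → indicator-∨ (does (vertex u ≟ y)) _ (f u) (not-both u)) ⟩
    sumF (λ u → indicator (does (vertex u ≟ y)) * f u + indicator (does (vertex u ∈? L)) * f u)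
      ≡⟨ sumF-+ {n} _ _ ⟩
    sumF (λ u → indicator (does (vertex u ≟ y)) * f u) + sumF (λ u → indicator (does (vertex u ∈? L)) * f u)
      ≡⟨ cong₂ _+_ (trans (sumF-cong (λ u → cong (λ b → indicator b * f u) (does-⇔ (is-index u) (vertex u ≟ y) (u Fin.≟ index y)))) (sumF-δ (index y) f))
                   (sumF-∈ L unique (decode ∘ there) f) ⟩
    f (index y) + sum (map (f ∘ index) L)
      ∎
    where
    open ≡-Reasoning
    is-index : ∀ u → (vertex u ≡ y) ⇔ (u ≡ index y)
    is-index u = mk⇔ (λ eq → trans (sym (index-vertex u)) (cong index eq)) (λ eq → trans (cong vertex eq) (decode (here refl)))
    not-both : ∀ u → ¬ (T (does (vertex u ≟ y)) × T (does (vertex u ∈? L)))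
    not-both u (is-y , in-L) = All.lookup y∉L (does-witness (vertex u ∈? L) in-L) (sym (does-witness (vertex u ≟ y) is-y))

iter-+ : ∀ {A : Set} (f : A → A) k s x → iter k f (iter s f x) ≡ iter (k + s) f x
iter-+ f zero    s x = refl
iter-+ f (suc k) s x = cong f (iter-+ f k s x)

iter-comm : ∀ {A : Set} (f : A → A) k x → iter k f (f x) ≡ f (iter k f x)
iter-comm f zero    x = refl
iter-comm f (suc k) x = cong f (iter-comm f k x)

iter-fixed : ∀ {A : Set} (f : A → A) {x} → f x ≡ x → ∀ k → iter k f x ≡ x
iter-fixed f fx≡x zero    = refl
iter-fixed f fx≡x (suc k) = trans (cong f (iter-fixed f fx≡x k)) fx≡x

orbit : ∀ {A : Set} → (A → A) → A → ℕ → List A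
orbit f a zero    = []
orbit f a (suc d) = a ∷ orbit f (f a) d

module _ {A : Set} (f : A → A) where

  ∈-orbit⁻ : ∀ {a x} d → x ∈ orbit f a d → ∃ λ j → j < d × iter j f a ≡ x
  ∈-orbit⁻ (suc d) (here refl) = 0 , s≤s z≤n , refl
  ∈-orbit⁻ {a} (suc d) (there x∈) with ∈-orbit⁻ d x∈
  ... | j , j<d , eq = suc j , s≤s j<d , trans (sym (iter-comm f j a)) eq

  ∈-orbit⁺ : ∀ {a j d} → j < d → iter j f a ∈ orbit f a d
  ∈-orbit⁺ {j = zero}  (s≤s _)   = here refl
  ∈-orbit⁺ {a} {suc j} (s≤s j<d) = there (subst (_∈ orbit f (f a) _) (iter-comm f j a) (∈-orbit⁺ j<d))

  map-orbit : ∀ a d → map f (orbit f a d) ≡ orbit f (f a) d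
  map-orbit a zero    = refl
  map-orbit a (suc d) = cong (f a ∷_) (map-orbit (f a) d)

  orbit-∷ʳ : ∀ a d → orbit f a (suc d) ≡ orbit f a d ∷ʳ iter d f a
  orbit-∷ʳ a zero    = refl
  orbit-∷ʳ a (suc d) = cong (a ∷_) (trans (orbit-∷ʳ (f a) d) (cong (orbit f (f a) d ∷ʳ_) (iter-comm f d a)))

  orbit-length : ∀ {a x d} → x ∈ orbit f a d → 0 < d
  orbit-length {d = suc d} _ = s≤s z≤n

  iter-pred : ∀ {d} → 0 < d → ∀ x → iter d f x ≡ iter (pred d) f (f x)
  iter-pred {suc d} _ x = sym (iter-comm f d x)

  orbit-head-unique : ∀ {a d} → 2 ≤ d → Unique (orbit f a d) → a ≢ f a
  orbit-head-unique {d = suc (suc d)} _ ((a≢fa ∷ _) ∷ _) = a≢fa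
  orbit-head-unique {d = suc zero} (s≤s ()) _

  orbit-sum-rotate : ∀ a d → iter d f a ≡ a → ∀ (g : A → ℕ) →
                     sum (map (g ∘ f) (orbit f a d)) ≡ sum (map g (orbit f a d))
  orbit-sum-rotate a zero    _      g = refl
  orbit-sum-rotate a (suc d) period g = begin
    sum (map (g ∘ f) (orbit f a (suc d)))            ≡⟨ cong sum (map-∘ (orbit f a (suc d))) ⟩
    sum (map g (map f (orbit f a (suc d))))          ≡⟨ cong (sum ∘ map g) (trans (map-orbit a (suc d)) (orbit-∷ʳ (f a) d)) ⟩
    sum (map g (orbit f (f a) d ∷ʳ iter d f (f a)))  ≡⟨ cong (λ z → sum (map g (orbit f (f a) d ∷ʳ z))) (trans (iter-comm f d a) period) ⟩
    sum (map g (orbit f (f a) d ∷ʳ a))               ≡⟨ cong sum (map-++ g (orbit f (f a) d) (a ∷ [])) ⟩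
    sum (map g (orbit f (f a) d) ++ g a ∷ [])        ≡⟨ sum-++ (map g (orbit f (f a) d)) (g a ∷ []) ⟩
    sum (map g (orbit f (f a) d)) + (g a + 0)        ≡⟨ cong (sum (map g (orbit f (f a) d)) +_) (+-identityʳ (g a)) ⟩
    sum (map g (orbit f (f a) d)) + g a              ≡⟨ +-comm _ (g a) ⟩
    sum (map g (orbit f a (suc d)))                  ∎
    where open ≡-Reasoning

  module Cycle (a : A) (d : ℕ) (period : iter d f a ≡ a) where

    periodic : ∀ {x} → x ∈ orbit f a d → iter d f x ≡ x
    periodic x∈ with ∈-orbit⁻ d x∈
    ... | j , _ , refl = begin
      iter d f (iter j f a)  ≡⟨ iter-+ f d j a ⟩
      iter (d + j) f a       ≡⟨ cong (λ k → iter k f a) (+-comm d j) ⟩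
      iter (j + d) f a       ≡⟨ iter-+ f j d a ⟨
      iter j f (iter d f a)  ≡⟨ cong (iter j f) period ⟩
      iter j f a             ∎
      where open ≡-Reasoning

    closed : ∀ {x} → x ∈ orbit f a d → f x ∈ orbit f a d
    closed x∈ with ∈-orbit⁻ d x∈
    ... | j , j<d , refl with suc j ℕ.≟ d
    ...   | no  1+j≢d = ∈-orbit⁺ (≤∧≢⇒< j<d 1+j≢d)
    ...   | yes refl  = subst (_∈ orbit f a d) (sym period) (∈-orbit⁺ {j = 0} (s≤s z≤n))

    connected : ∀ {x y} → x ∈ orbit f a d → y ∈ orbit f a d → ∃ λ k → iter k f x ≡ y
    connected x∈ y∈ with ∈-orbit⁻ d x∈ | ∈-orbit⁻ d y∈
    ... | j , j<d , refl | j′ , _ , refl = j′ + (d ∸ j) , (begin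
      iter (j′ + (d ∸ j)) f (iter j f a)  ≡⟨ iter-+ f (j′ + (d ∸ j)) j a ⟩
      iter (j′ + (d ∸ j) + j) f a         ≡⟨ cong (λ k → iter k f a) (trans (+-assoc j′ (d ∸ j) j) (cong (j′ +_) (m∸n+n≡m (<⇒≤ j<d)))) ⟩
      iter (j′ + d) f a                   ≡⟨ iter-+ f j′ d a ⟨
      iter j′ f (iter d f a)              ≡⟨ cong (iter j′ f) period ⟩
      iter j′ f a                         ∎)
      where open ≡-Reasoning

    injective : ∀ {x y} → x ∈ orbit f a d → y ∈ orbit f a d → f x ≡ f y → x ≡ y
    injective {x} {y} x∈ y∈ fx≡fy = begin
      x                       ≡⟨ periodic x∈ ⟨
      iter d f x              ≡⟨ iter-pred (orbit-length x∈) x ⟩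
      iter (pred d) f (f x)   ≡⟨ cong (iter (pred d) f) fx≡fy ⟩
      iter (pred d) f (f y)   ≡⟨ iter-pred (orbit-length x∈) y ⟨
      iter d f y              ≡⟨ periodic y∈ ⟩
      y                       ∎
      where open ≡-Reasoning

    fixed-point-free : 2 ≤ d → Unique (orbit f a d) → ∀ {x} → x ∈ orbit f a d → f x ≢ x
    fixed-point-free 2≤d unique x∈ fx≡x with ∈-orbit⁻ d x∈
    ... | j , j<d , refl = orbit-head-unique 2≤d unique (trans a≡x (sym (trans (cong f a≡x) fx≡x)))
      where
      open ≡-Reasoning
      a≡x : a ≡ iter j f a
      a≡x = begin
        a                                ≡⟨ period ⟨
        iter d f a                       ≡⟨ cong (λ k → iter k f a) (m∸n+n≡m (<⇒≤ j<d)) ⟨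
        iter (d ∸ j + j) f a             ≡⟨ iter-+ f (d ∸ j) j a ⟨
        iter (d ∸ j) f (iter j f a)      ≡⟨ iter-fixed f fx≡x (d ∸ j) ⟩
        iter j f a                       ∎

    sum-invariant : ∀ (g : A → ℕ) → sum (map (g ∘ f) (orbit f a d)) ≡ sum (map g (orbit f a d))
    sum-invariant g = orbit-sum-rotate a d period g

argmin : ∀ {k} (r : Fin (suc k) → ℕ) → ∃ λ s → ∀ t → r s ≤ r t
argmin {zero}  r = fz , λ { fz → ≤-refl }
argmin {suc k} r with argmin (r ∘ fs)
... | s , min with r fz ℕ.≤? r (fs s)
...   | yes r0≤ = fz , λ { fz → ≤-refl ; (fs t) → ≤-trans r0≤ (min t) }
...   | no  r0≰ = fs s , λ { fz → <⇒≤ (≰⇒> r0≰) ; (fs t) → min t }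

allBelow-sound : ∀ K p → T (allBelow K p) → ∀ k → k < K → T (p k)
allBelow-sound (suc K) p all k k<1+K with p K in pK | k ℕ.≟ K
... | true  | yes refl = subst T (sym pK) _
... | true  | no  k≢K  = allBelow-sound K p all k (≤∧≢⇒< (s≤s⁻¹ k<1+K) k≢K)
... | false | _        = ⊥-elim all

allBelow-complete : ∀ K p → (∀ k → k < K → T (p k)) → T (allBelow K p)
allBelow-complete zero    p all = _
allBelow-complete (suc K) p all with p K in pK
... | true  = allBelow-complete K p (λ k k<K → all k (≤-trans k<K (n≤1+n K)))
... | false = subst T pK (all K ≤-refl)

rank-injective : ∀ {n} (d e : Dart n) → rank d ≡ rank e → d ≡ e
rank-injective {n} (u , v) (u′ , v′) eq =
  let u≡ , v≡ = combine-injective u v u′ v′ (toℕ-injective (begin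
        toℕ (combine u v)     ≡⟨ toℕ-combine u v ⟩
        n * toℕ u + toℕ v     ≡⟨ cong (_+ toℕ v) (*-comm n (toℕ u)) ⟩
        rank (u , v)          ≡⟨ eq ⟩
        rank (u′ , v′)        ≡⟨ cong (_+ toℕ v′) (*-comm (toℕ u′) n) ⟩
        n * toℕ u′ + toℕ v′   ≡⟨ toℕ-combine u′ v′ ⟨
        toℕ (combine u′ v′)   ∎))
  in cong₂ _,_ u≡ v≡
  where open ≡-Reasoning

module RotationFaces {n} (G : Graph n) (R : Rotation G) where

  infix 4 _~ᴳ_
  _~ᴳ_ : Fin n → Fin n → Set
  _~ᴳ_ = _~_ G

  φ : Dart n → Dart n
  φ = faceStep R

  dartSum : (Dart n → ℕ) → ℕ
  dartSum h = sumF (λ u → sumF (λ v → indicator (adj G u v) * h (u , v)))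

  dartSum-sumF : ∀ {k} (h : Fin k → Dart n → ℕ) → dartSum (λ d → sumF (λ s → h s d)) ≡ sumF (λ s → dartSum (h s))
  dartSum-sumF h = begin
    dartSum (λ d → sumF (λ s → h s d))
      ≡⟨ sumF-cong (λ u → sumF-cong (λ v → *-sumF (indicator (adj G u v)) (λ s → h s (u , v)))) ⟩
    sumF (λ u → sumF (λ v → sumF (λ s → indicator (adj G u v) * h s (u , v))))
      ≡⟨ sumF-cong (λ u → sumF-comm (λ v s → indicator (adj G u v) * h s (u , v))) ⟩
    sumF (λ u → sumF (λ s → sumF (λ v → indicator (adj G u v) * h s (u , v))))
      ≡⟨ sumF-comm (λ u s → sumF (λ v → indicator (adj G u v) * h s (u , v))) ⟩
    sumF (λ s → dartSum (h s))
      ∎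
    where open ≡-Reasoning

  dartSum-φ : (∀ v (g : Fin n → ℕ) → sumF (λ u → indicator (adj G v u) * g (σ R v u)) ≡ sumF (λ u → indicator (adj G v u) * g u)) →
              ∀ h → dartSum (h ∘ φ) ≡ dartSum h
  dartSum-φ permutes h = begin
    sumF (λ u → sumF (λ v → indicator (adj G u v) * h (v , σ R v u)))  ≡⟨ sumF-comm (λ u v → indicator (adj G u v) * h (v , σ R v u)) ⟩
    sumF (λ v → sumF (λ u → indicator (adj G u v) * h (v , σ R v u)))  ≡⟨ sumF-cong (λ v → sumF-cong (λ u → cong (λ b → indicator b * h (v , σ R v u)) (Graph.sym G u v))) ⟩
    sumF (λ v → sumF (λ u → indicator (adj G v u) * h (v , σ R v u)))  ≡⟨ sumF-cong (λ v → permutes v (λ w → h (v , w))) ⟩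
    dartSum h                                                            ∎
    where open ≡-Reasoning

  dartSum-cong : ∀ {h h′ : Dart n → ℕ} → (∀ {u v} → u ~ᴳ v → h (u , v) ≡ h′ (u , v)) → dartSum h ≡ dartSum h′
  dartSum-cong {h} {h′} h≗h′ = sumF-cong (λ u → sumF-cong (λ v → on-dart u v))
    where
    on-dart : ∀ u v → indicator (adj G u v) * h (u , v) ≡ indicator (adj G u v) * h′ (u , v)
    on-dart u v with adj G u v in uv
    ... | false = refl
    ... | true  = cong (λ x → 1 * x) (h≗h′ (subst T (sym uv) _))

  numDarts-dartSum : numDarts G ≡ dartSum (λ _ → 1)
  numDarts-dartSum = sumF-cong (λ u → trans (count-sumF (adj G u)) (sumF-cong {n} (λ v → sym (*-identityʳ _))))

  numFaces-dartSum : numFaces R ≡ dartSum (indicator ∘ isFaceRep R)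
  numFaces-dartSum = sumF-cong (λ u → trans (count-sumF {n} (λ v → adj G u v ∧ isFaceRep R (u , v))) (sumF-cong {n} (λ v → indicator-∧ (adj G u v) _)))

  ~-sym : ∀ {u v} → u ~ᴳ v → v ~ᴳ u
  ~-sym {u} {v} = subst T (Graph.sym G u v)

  φ-dart : ∀ {u v} → u ~ᴳ v → proj₁ (φ (u , v)) ~ᴳ proj₂ (φ (u , v))
  φ-dart {u} {v} u~v = Rotation.closed R v u (~-sym u~v)

  iter-φ-dart : ∀ {u v} → u ~ᴳ v → ∀ k → proj₁ (iter k φ (u , v)) ~ᴳ proj₂ (iter k φ (u , v))
  iter-φ-dart u~v zero    = u~v
  iter-φ-dart u~v (suc k) = φ-dart (iter-φ-dart u~v k)

  ~-irrefl : ∀ {u v} → u ~ᴳ v → u ≢ v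
  ~-irrefl {u} u~u refl = subst T (Graph.irref G u) u~u

  -- isFaceRep compares a dart with its first n * n iterates only; within a face of four darts
  -- every dart is reached from every other in fewer than 8 steps.
  module Quadrangular
    (fixed-point-free : ∀ v u → v ~ᴳ u → σ R v u ≢ u)
    (permutes : ∀ v (g : Fin n → ℕ) → sumF (λ u → indicator (adj G v u) * g (σ R v u)) ≡ sumF (λ u → indicator (adj G v u) * g u))
    (quadrilateral : ∀ {u v} → u ~ᴳ v → iter 4 φ (u , v) ≡ (u , v))
    (8≤n*n : 8 ≤ n * n)
    where

    -- As σ has no fixed points the four corners of a face are distinct, so exactly one of its
    -- four darts is the rank-minimal representative counted by numFaces.
    module Face {u v} (u~v : u ~ᴳ v) where

      dart : Fin 4 → Dart n
      dart s = iter (toℕ s) φ (u , v)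

      corners : List (Fin n)
      corners = u ∷ v ∷ proj₁ (dart 2F) ∷ proj₁ (dart 3F) ∷ []

      corners-unique : Unique corners
      corners-unique = (~-irrefl u~v ∷ (λ eq → fixed-point-free v u (~-sym u~v) (sym eq)) ∷ (λ eq → ~-irrefl (edge 3F) (trans (sym eq) (sym closes))) ∷ [])
                     ∷ (~-irrefl (edge 1F) ∷ (λ eq → fixed-point-free _ v (~-sym (edge 1F)) (sym eq)) ∷ [])
                     ∷ (~-irrefl (edge 2F) ∷ [])
                     ∷ [] ∷ []
        where
        edge : ∀ (s : Fin 4) → proj₁ (dart s) ~ᴳ proj₂ (dart s)
        edge s = iter-φ-dart u~v (toℕ s)
        closes : proj₁ (iter 4 φ (u , v)) ≡ u
        closes = cong proj₁ (quadrilateral u~v)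

      dart-corner : ∀ s → proj₁ (dart s) ≡ lookup corners s
      dart-corner 0F = refl
      dart-corner 1F = refl
      dart-corner 2F = refl
      dart-corner 3F = refl

      dart-injective : ∀ s t → dart s ≡ dart t → s ≡ t
      dart-injective s t eq = lookup-injective corners-unique s t
        (trans (sym (dart-corner s)) (trans (cong proj₁ eq) (dart-corner t)))

      iterate-in-face : ∀ k → ∃ λ s → iter k φ (u , v) ≡ dart s
      iterate-in-face zero = 0F , refl
      iterate-in-face (suc k) with iterate-in-face k
      ... | 0F , eq = 1F , cong φ eq
      ... | 1F , eq = 2F , cong φ eq
      ... | 2F , eq = 3F , cong φ eq
      ... | 3F , eq = 0F , trans (cong φ eq) (quadrilateral u~v)

      dart-reaches : ∀ s t → ∃ λ j → j < 8 × iter j φ (dart s) ≡ dart t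
      dart-reaches s t = 4 ∸ toℕ s + toℕ t , j<8 , (begin
        iter (4 ∸ toℕ s + toℕ t) φ (dart s)   ≡⟨ iter-+ φ (4 ∸ toℕ s + toℕ t) (toℕ s) (u , v) ⟩
        iter (4 ∸ toℕ s + toℕ t + toℕ s) φ (u , v)
          ≡⟨ cong (λ j → iter j φ (u , v)) (trans (+-comm (4 ∸ toℕ s + toℕ t) (toℕ s)) (solve-shift (toℕ s) (toℕ t) (toℕ≤pred[n] s))) ⟩
        iter (toℕ t + 4) φ (u , v)            ≡⟨ iter-+ φ (toℕ t) 4 (u , v) ⟨
        iter (toℕ t) φ (iter 4 φ (u , v))     ≡⟨ cong (iter (toℕ t) φ) (quadrilateral u~v) ⟩
        dart t                                ∎)
        where
        open ≡-Reasoning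
        j<8 : 4 ∸ toℕ s + toℕ t < 8
        j<8 = s≤s (+-mono-≤ (m∸n≤m 4 (toℕ s)) (toℕ≤pred[n] t))
        solve-shift : ∀ a b → a ≤ 3 → a + (4 ∸ a + b) ≡ b + 4
        solve-shift a b a≤3 = trans (sym (+-assoc a (4 ∸ a) b)) (trans (cong (_+ b) (m+[n∸m]≡n (≤-trans a≤3 (n≤1+n 3)))) (+-comm 4 b))

      rep-unique : ∀ s t → T (isFaceRep R (dart s)) → T (isFaceRep R (dart t)) → s ≡ t
      rep-unique s t rep-s rep-t = dart-injective s t (rank-injective _ _ (≤-antisym (below s t rep-s) (below t s rep-t)))
        where
        below : ∀ s t → T (isFaceRep R (dart s)) → rank (dart s) ≤ rank (dart t)
        below s t rep with dart-reaches s t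
        ... | j , j<8 , eq = subst (λ d → rank (dart s) ≤ rank d) eq
          (≤ᵇ⇒≤ _ _ (allBelow-sound (n * n) _ rep j (≤-trans j<8 8≤n*n)))

      rep-exists : ∃ λ s → T (isFaceRep R (dart s))
      rep-exists with argmin (rank ∘ dart)
      ... | s , minimal = s , allBelow-complete (n * n) _ (λ k _ → ≤⇒≤ᵇ (below k))
        where
        below : ∀ k → rank (dart s) ≤ rank (iter k φ (dart s))
        below k with iterate-in-face (k + toℕ s)
        ... | t , eq = subst (λ d → rank (dart s) ≤ rank d) (sym (trans (iter-+ φ k (toℕ s) (u , v)) eq)) (minimal t)

      one-rep : sumF (λ s → indicator (isFaceRep R (dart s))) ≡ 1
      one-rep = sumF-indicator-unique _ rep-unique rep-exists

    numFaces-iter : ∀ s → dartSum (indicator ∘ isFaceRep R ∘ iter s φ) ≡ numFaces R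
    numFaces-iter zero    = sym numFaces-dartSum
    numFaces-iter (suc s) = begin
      dartSum (indicator ∘ isFaceRep R ∘ iter (suc s) φ)      ≡⟨ dartSum-cong (λ {u} {v} _ → cong (indicator ∘ isFaceRep R) (sym (iter-comm φ s (u , v)))) ⟩
      dartSum ((indicator ∘ isFaceRep R ∘ iter s φ) ∘ φ)      ≡⟨ dartSum-φ permutes (indicator ∘ isFaceRep R ∘ iter s φ) ⟩
      dartSum (indicator ∘ isFaceRep R ∘ iter s φ)            ≡⟨ numFaces-iter s ⟩
      numFaces R                                              ∎
      where open ≡-Reasoning

    numDarts≡4*numFaces : numDarts G ≡ 4 * numFaces R
    numDarts≡4*numFaces = begin
      numDarts G                                                                ≡⟨ numDarts-dartSum ⟩
      dartSum (λ _ → 1)                                                         ≡⟨ dartSum-cong (λ u~v → sym (Face.one-rep u~v)) ⟩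
      dartSum (λ d → sumF {4} (λ s → indicator (isFaceRep R (iter (toℕ s) φ d)))) ≡⟨ dartSum-sumF {4} (λ s → indicator ∘ isFaceRep R ∘ iter (toℕ s) φ) ⟩
      sumF {4} (λ s → dartSum (indicator ∘ isFaceRep R ∘ iter (toℕ s) φ))      ≡⟨ sumF-cong {4} (numFaces-iter ∘ toℕ) ⟩
      sumF {4} (λ _ → numFaces R)                                               ≡⟨ sumF-const 4 (numFaces R) ⟩
      4 * numFaces R                                                            ∎
      where open ≡-Reasoning

    -- For a quadrangulation 2|F| = |E|, so Euler's formula amounts to |E| = 2|V| - 4.
    planar : numDarts G + 8 ≡ 4 * n → Planar G
    planar D+8≡4n = R , (begin
      2 * n + 2 * F                 ≡⟨ cong (λ m → 2 * m + 2 * F) n≡F+2 ⟩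
      2 * (F + 2) + 2 * F           ≡⟨ solve 1 (λ F → con 2 :* (F :+ con 2) :+ con 2 :* F := con 4 :* F :+ con 4) refl F ⟩
      4 * F + 4                     ≡⟨ cong (_+ 4) (sym numDarts≡4*numFaces) ⟩
      numDarts G + 4                ∎)
      where
      open ≡-Reasoning
      F = numFaces R
      n≡F+2 : n ≡ F + 2
      n≡F+2 = *-cancelˡ-≡ n (F + 2) 4 (begin
        4 * n            ≡⟨ D+8≡4n ⟨
        numDarts G + 8   ≡⟨ cong (_+ 8) numDarts≡4*numFaces ⟩
        4 * F + 8        ≡⟨ solve 1 (λ F → con 4 :* F :+ con 8 := con 4 :* (F :+ con 2)) refl F ⟩
        4 * (F + 2)      ∎)

module _ {n} (G : Graph n) where

  private
    infix 4 _~ᴳ_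
    _~ᴳ_ : Fin n → Fin n → Set
    _~ᴳ_ = _~_ G

  triangle-free : (side : Fin n → Bool) → (∀ {u v} → u ~ᴳ v → side v ≡ not (side u)) → ¬ HasCycle G 3
  triangle-free side alternates (_ , f , _ , closed-walk) = not-¬ refl (begin
    side (f 0F)              ≡⟨ alternates (closed-walk 2F) ⟩
    not (side (f 2F))        ≡⟨ cong not (alternates (closed-walk 1F)) ⟩
    not (not (side (f 1F)))  ≡⟨ not-involutive _ ⟩
    side (f 1F)              ≡⟨ alternates (closed-walk 0F) ⟩
    not (side (f 0F))        ∎)
    where open ≡-Reasoning

  girth-four : ¬ HasCycle G 3 → HasCycle G 4 → Girth G 4
  girth-four no-triangle square = square , shorter
    where
    shorter : ∀ k → k < 4 → ¬ HasCycle G k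
    shorter 3 _ = no-triangle
    shorter 0 _ (() , _)
    shorter 1 _ (s≤s () , _)
    shorter 2 _ (s≤s (s≤s ()) , _)
    shorter (suc (suc (suc (suc _)))) (s≤s (s≤s (s≤s (s≤s ())))) _

  injective-colouring-bound : ∀ {k} (x : Fin k → Fin n) →
    (∀ {s t} → s Fin.< t → x s ≢ x t × ∃ λ w → x s ~ᴳ w × x t ~ᴳ w) →
    ∀ j → j < k → ¬ Σ (Fin n → Fin j) (InjectiveColouring G j)
  injective-colouring-bound x clash j j<k (c , injective) with pigeonhole j<k (c ∘ x)
  ... | s , t , s<t , same with clash s<t
  ...   | xs≢xt , w , xs~w , xt~w = injective (x s) (x t) w xs≢xt xs~w xt~w same

  module _ {ok : Fin n → Set} where

    reach-trans : ∀ {u v w} → Reach G ok u v → Reach G ok v w → Reach G ok u w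
    reach-trans here                 r = r
    reach-trans (step u~w ok-w w⇝v) r = step u~w ok-w (reach-trans w⇝v r)

    reach-sym : ∀ {u v} → ok u → Reach G ok u v → Reach G ok v u
    reach-sym ok-u here = here
    reach-sym {u} ok-u (step {w = w} u~w ok-w w⇝v) =
      reach-trans (reach-sym ok-w w⇝v) (step (subst T (Graph.sym G u w) u~w) ok-u here)

Layer : Set
Layer = Fin 3

pattern inner  = 0F
pattern centre = 1F
pattern outer  = 2F

-- node i j l k lies in block i with j blocks after it; storing j makes the last block visible
-- to pattern matching.
data Vertex : Set where
  source sink : Vertex
  node : (i j : ℕ) → Layer → Fin 3 → Vertex

node-injective : ∀ {i j l k i′ j′ l′ k′} → node i j l k ≡ node i′ j′ l′ k′ → i ≡ i′ × j ≡ j′ × l ≡ l′ × k ≡ k′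
node-injective refl = refl , refl , refl , refl

_≟ᵛ_ : DecidableEquality Vertex
source ≟ᵛ source = yes refl
sink   ≟ᵛ sink   = yes refl
source ≟ᵛ sink   = no λ ()
sink   ≟ᵛ source = no λ ()
source ≟ᵛ node _ _ _ _ = no λ ()
sink   ≟ᵛ node _ _ _ _ = no λ ()
node _ _ _ _ ≟ᵛ source = no λ ()
node _ _ _ _ ≟ᵛ sink   = no λ ()
node i j l k ≟ᵛ node i′ j′ l′ k′ =
  map′ (λ { (refl , refl , refl , refl) → refl }) node-injective
       (i ℕ.≟ i′ ×-dec j ℕ.≟ j′ ×-dec l Fin.≟ l′ ×-dec k Fin.≟ k′)

prev : Fin 3 → Fin 3
prev 0F = 2F
prev 1F = 0F
prev 2F = 1F

prev-next : ∀ k → prev (next k) ≡ k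
prev-next 0F = refl
prev-next 1F = refl
prev-next 2F = refl

next-prev : ∀ k → next (prev k) ≡ k
next-prev 0F = refl
next-prev 1F = refl
next-prev 2F = refl

-- The neighbours of a vertex differ in layer or residue, so the rotation compares only these and
-- evaluates even when block indices are variables.
sameSlot : Vertex → Vertex → Bool
sameSlot source         source           = true
sameSlot sink           sink             = true
sameSlot (node _ _ l k) (node _ _ l′ k′) = does (l Fin.≟ l′) ∧ does (k Fin.≟ k′)
sameSlot _              _                = false

succIn : List Vertex → Vertex → Vertex
succIn []      y = y
succIn (h ∷ t) y = after (h ∷ t)
  where
  after : List Vertex → Vertex
  after []           = h
  after (_ ∷ [])     = h
  after (z ∷ w ∷ zs) = if sameSlot y z then w else after (w ∷ zs)

findSlot : Vertex → List Vertex → Maybe Vertex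
findSlot x []       = nothing
findSlot x (y ∷ ys) = if sameSlot x y then just y else findSlot x ys

distinctSlots : List Vertex → Bool
distinctSlots []       = true
distinctSlots (x ∷ xs) = is-nothing (findSlot x xs) ∧ distinctSlots xs

sameSlot-refl : ∀ x → T (sameSlot x x)
sameSlot-refl source         = _
sameSlot-refl sink           = _
sameSlot-refl (node _ _ l k) rewrite dec-true (l Fin.≟ l) refl | dec-true (k Fin.≟ k) refl = _

findSlot-∈ : ∀ {x y} L → findSlot x L ≡ just y → y ∈ L
findSlot-∈ {x} (z ∷ zs) found with sameSlot x z
... | true  = here (sym (just-injective found))
... | false = there (findSlot-∈ zs found)

findSlot-∉ : ∀ {x} L → T (is-nothing (findSlot x L)) → All (x ≢_) L
findSlot-∉         []       _       = []
findSlot-∉ {x} (z ∷ zs) missing with sameSlot x z in same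
... | false = (λ { refl → subst T same (sameSlot-refl x) }) ∷ findSlot-∉ zs missing

distinctSlots-unique : ∀ L → T (distinctSlots L) → Unique L
distinctSlots-unique []       _        = []
distinctSlots-unique (x ∷ xs) distinct =
  let x-new , xs-distinct = Equivalence.to T-∧ distinct
  in findSlot-∉ xs x-new ∷ distinctSlots-unique xs xs-distinct

clamp : ∀ n → ℕ → Fin (suc n)
clamp n       zero    = fz
clamp zero    (suc i) = fz
clamp (suc n) (suc i) = fs (clamp n i)

toℕ-clamp : ∀ {n i} → i ≤ n → toℕ (clamp n i) ≡ i
toℕ-clamp {n}     {zero}  _         = refl
toℕ-clamp {suc n} {suc i} (s≤s i≤n) = cong suc (toℕ-clamp i≤n)

clamp-toℕ : ∀ {n} (b : Fin (suc n)) → clamp n (toℕ b) ≡ b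
clamp-toℕ {n}     fz     = refl
clamp-toℕ {suc n} (fs b) = cong fs (clamp-toℕ b)

module Construction (N : ℕ) where

  Valid : Vertex → Set
  Valid source         = ⊤
  Valid sink           = ⊤
  Valid (node i j _ _) = i + j ≡ suc N

  below : ℕ → ℕ → Fin 3 → List Vertex
  below zero    j k = source ∷ []
  below (suc i) j k = node i (suc j) outer (next k) ∷ node i (suc j) outer k ∷ []

  above : ℕ → ℕ → Fin 3 → List Vertex
  above i zero    k = sink ∷ []
  above i (suc j) k = node (suc i) j inner (prev k) ∷ node (suc i) j inner k ∷ []

  nbrs : Vertex → List Vertex
  nbrs source              = node 0 (suc N) inner 0F ∷ node 0 (suc N) inner 1F ∷ node 0 (suc N) inner 2F ∷ []
  nbrs sink                = node (suc N) 0 outer 0F ∷ node (suc N) 0 outer 2F ∷ node (suc N) 0 outer 1F ∷ []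
  nbrs (node i j centre k) = node i j inner k ∷ node i j inner (prev k) ∷ node i j outer (prev k) ∷ node i j outer k ∷ []
  nbrs (node i j inner k)  = node i j centre k ∷ node i j centre (next k) ∷ below i j k
  nbrs (node i j outer k)  = node i j centre (next k) ∷ node i j centre k ∷ above i j k

  rot : Vertex → Vertex → Vertex
  rot x = succIn (nbrs x)

  data Block : ℕ → ℕ → Set where
    first  : Block 0 (suc N)
    middle : ∀ i j → Block (suc i) (suc j)
    final  : Block (suc N) 0

  block : ∀ i j → i + j ≡ suc N → Block i j
  block zero    j       refl = first
  block (suc i) (suc j) _    = middle i j
  block (suc i) zero    eq   with trans (sym (+-identityʳ (suc i))) eq
  ... | refl = final

  φV : Vertex × Vertex → Vertex × Vertex
  φV (x , y) = y , rot y x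

  record Neighbourhood (x : Vertex) : Set where
    constructor neighbourhood
    field
      start       : Vertex
      cycle       : nbrs x ≡ orbit (rot x) start (length (nbrs x))
      period      : iter (length (nbrs x)) (rot x) start ≡ start
      distinct    : T (distinctSlots (nbrs x))
      loopless    : findSlot x (nbrs x) ≡ nothing
      symmetric   : map (λ y → findSlot x (nbrs y)) (nbrs x) ≡ map (λ _ → just x) (nbrs x)
      quadrangles : map (λ y → iter 4 φV (x , y)) (nbrs x) ≡ map (x ,_) (nbrs x)
      branching   : 2 ≤ length (nbrs x)

  -- Each field holds by evaluation once the block position and the residue are known.
  pattern computed = neighbourhood _ refl refl _ refl refl refl (s≤s (s≤s z≤n))

  centre-neighbourhood : ∀ {i j} → Block i j → ∀ k → Neighbourhood (node i j centre k)
  centre-neighbourhood first        0F = computed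
  centre-neighbourhood first        1F = computed
  centre-neighbourhood first        2F = computed
  centre-neighbourhood (middle _ _) 0F = computed
  centre-neighbourhood (middle _ _) 1F = computed
  centre-neighbourhood (middle _ _) 2F = computed
  centre-neighbourhood final        0F = computed
  centre-neighbourhood final        1F = computed
  centre-neighbourhood final        2F = computed

  neighbourhood-of : ∀ x → Valid x → Neighbourhood x
  neighbourhood-of source                    _         = computed
  neighbourhood-of sink                      _         = computed
  neighbourhood-of (node i j centre k)       v         = centre-neighbourhood (block i j v) k
  neighbourhood-of (node zero _ inner 0F)    refl      = computed
  neighbourhood-of (node zero _ inner 1F)    refl      = computed
  neighbourhood-of (node zero _ inner 2F)    refl      = computed
  neighbourhood-of (node (suc i) j inner 0F) _         = computed
  neighbourhood-of (node (suc i) j inner 1F) _         = computed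
  neighbourhood-of (node (suc i) j inner 2F) _         = computed
  neighbourhood-of (node i (suc j) outer 0F) _         = computed
  neighbourhood-of (node i (suc j) outer 1F) _         = computed
  neighbourhood-of (node i (suc j) outer 2F) _         = computed
  neighbourhood-of (node i zero outer k)     v with block i zero v
  neighbourhood-of (node _ zero outer 0F)    _ | final = computed
  neighbourhood-of (node _ zero outer 1F)    _ | final = computed
  neighbourhood-of (node _ zero outer 2F)    _ | final = computed

  module _ {x} (valid : Valid x) where
    open Neighbourhood (neighbourhood-of x valid)

    nbrs-unique : Unique (nbrs x)
    nbrs-unique = distinctSlots-unique (nbrs x) distinct

    nbrs-loopless : x ∉ nbrs x
    nbrs-loopless x∈ = All.lookup (findSlot-∉ (nbrs x) (subst (T ∘ is-nothing) (sym loopless) _)) x∈ refl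

    nbrs-symmetric : ∀ {y} → y ∈ nbrs x → x ∈ nbrs y
    nbrs-symmetric {y} y∈ = findSlot-∈ (nbrs y) (map-≡-∈ (nbrs x) symmetric y∈)

    face-quadrangle : ∀ {y} → y ∈ nbrs x → iter 4 φV (x , y) ≡ (x , y)
    face-quadrangle = map-≡-∈ (nbrs x) quadrangles

    private
      module Orbit = Cycle (rot x) start (length (nbrs x)) period
      in-orbit : ∀ {y} → y ∈ nbrs x → y ∈ orbit (rot x) start (length (nbrs x))
      in-orbit = subst (_ ∈_) cycle

    rot-∈ : ∀ {y} → y ∈ nbrs x → rot x y ∈ nbrs x
    rot-∈ y∈ = subst (_ ∈_) (sym cycle) (Orbit.closed (in-orbit y∈))

    rot-injective : ∀ {y z} → y ∈ nbrs x → z ∈ nbrs x → rot x y ≡ rot x z → y ≡ z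
    rot-injective y∈ z∈ = Orbit.injective (in-orbit y∈) (in-orbit z∈)

    rot-connected : ∀ {y z} → y ∈ nbrs x → z ∈ nbrs x → ∃ λ k → iter k (rot x) y ≡ z
    rot-connected y∈ z∈ = Orbit.connected (in-orbit y∈) (in-orbit z∈)

    rot-fixed-point-free : ∀ {y} → y ∈ nbrs x → rot x y ≢ y
    rot-fixed-point-free y∈ = Orbit.fixed-point-free branching (subst Unique cycle nbrs-unique) (in-orbit y∈)

    sum-map-rot : ∀ (g : Vertex → ℕ) → sum (map (g ∘ rot x) (nbrs x)) ≡ sum (map g (nbrs x))
    sum-map-rot g = subst (λ L → sum (map (g ∘ rot x) L) ≡ sum (map g L)) (sym cycle) (Orbit.sum-invariant g)

  nbrs-valid : ∀ {x} → Valid x → All Valid (nbrs x)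
  nbrs-valid {source}                 _ = refl ∷ refl ∷ refl ∷ []
  nbrs-valid {sink}                   _ = +-identityʳ (suc N) ∷ +-identityʳ (suc N) ∷ +-identityʳ (suc N) ∷ []
  nbrs-valid {node _ _ centre _}      v = v ∷ v ∷ v ∷ v ∷ []
  nbrs-valid {node zero _ inner _}    v = v ∷ v ∷ _ ∷ []
  nbrs-valid {node (suc i) j inner _} v = v ∷ v ∷ trans (+-suc i j) v ∷ trans (+-suc i j) v ∷ []
  nbrs-valid {node _ zero outer _}    v = v ∷ v ∷ _ ∷ []
  nbrs-valid {node i (suc j) outer _} v = v ∷ v ∷ trans (sym (+-suc i j)) v ∷ trans (sym (+-suc i j)) v ∷ []

  blocks : ℕ
  blocks = suc (suc N)

  nV : ℕ
  nV = 2 + blocks * 9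

  boundary : Fin 2 → Vertex
  boundary 0F = source
  boundary 1F = sink

  -- Block vertices are numbered by (block, layer, residue) in mixed radix (blocks, 3, 3).
  slotOf : Fin 9 → Layer × Fin 3
  slotOf = remQuot 3

  blockOf : Fin (blocks * 9) → Fin blocks × Fin 9
  blockOf = remQuot 9

  blockNode : ℕ → ℕ → Fin 9 → Vertex
  blockNode i j p = node i j (proj₁ (slotOf p)) (proj₂ (slotOf p))

  nodeAt : Fin blocks × Fin 9 → Vertex
  nodeAt (b , p) = blockNode (toℕ b) (suc N ∸ toℕ b) p

  vertex : Fin nV → Vertex
  vertex u = [ boundary , nodeAt ∘ blockOf ]′ (splitAt 2 u)

  index : Vertex → Fin nV
  index source         = 0F
  index sink           = 1F
  index (node i _ l k) = 2 ↑ʳ combine (clamp (suc N) i) (combine l k)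

  index-vertex : ∀ u → index (vertex u) ≡ u
  index-vertex u with splitAt 2 u in split
  ... | inj₁ 0F = trans (sym (cong (join 2 (blocks * 9)) split)) (join-splitAt 2 _ u)
  ... | inj₁ 1F = trans (sym (cong (join 2 (blocks * 9)) split)) (join-splitAt 2 _ u)
  ... | inj₂ w  = begin
    2 ↑ʳ combine (clamp (suc N) (toℕ b)) (combine (proj₁ (slotOf p)) (proj₂ (slotOf p)))
      ≡⟨ cong₂ (λ b′ p′ → 2 ↑ʳ combine b′ p′) (clamp-toℕ b) (combine-remQuot {3} 3 p) ⟩
    2 ↑ʳ combine b p         ≡⟨ cong (2 ↑ʳ_) (combine-remQuot {blocks} 9 w) ⟩
    join 2 _ (inj₂ w)        ≡⟨ cong (join 2 _) split ⟨
    join 2 _ (splitAt 2 u)   ≡⟨ join-splitAt 2 _ u ⟩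
    u                        ∎
    where
    open ≡-Reasoning
    b = proj₁ (blockOf w)
    p = proj₂ (blockOf w)

  vertex-index : ∀ {x} → Valid x → vertex (index x) ≡ x
  vertex-index {source} _ = refl
  vertex-index {sink}   _ = refl
  vertex-index {node i j l k} i+j≡ = begin
    [ boundary , nodeAt ∘ blockOf ]′ (splitAt 2 (2 ↑ʳ combine (clamp (suc N) i) (combine l k)))
      ≡⟨ cong [ boundary , nodeAt ∘ blockOf ]′ (splitAt-↑ʳ 2 (blocks * 9) (combine (clamp (suc N) i) (combine l k))) ⟩
    nodeAt (blockOf (combine (clamp (suc N) i) (combine l k)))
      ≡⟨ cong nodeAt (remQuot-combine {blocks} {9} (clamp (suc N) i) (combine l k)) ⟩
    node (toℕ (clamp (suc N) i)) (suc N ∸ toℕ (clamp (suc N) i)) (proj₁ (slotOf (combine l k))) (proj₂ (slotOf (combine l k)))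
      ≡⟨ cong₂ (λ i′ lk → node i′ (suc N ∸ i′) (proj₁ lk) (proj₂ lk)) toℕ-i (remQuot-combine {3} {3} l k) ⟩
    node i (suc N ∸ i) l k
      ≡⟨ cong (λ j′ → node i j′ l k) (trans (cong (_∸ i) (sym i+j≡)) (m+n∸m≡n i j)) ⟩
    node i j l k
      ∎
    where
    open ≡-Reasoning
    toℕ-i : toℕ (clamp (suc N) i) ≡ i
    toℕ-i = toℕ-clamp (subst (i ≤_) i+j≡ (m≤m+n i j))

  vertex-valid : ∀ u → Valid (vertex u)
  vertex-valid u with splitAt 2 u
  ... | inj₁ 0F = _
  ... | inj₁ 1F = _
  ... | inj₂ w  = m+[n∸m]≡n (toℕ≤pred[n] (proj₁ (blockOf w)))

  open import Data.List.Membership.DecPropositional _≟ᵛ_ using (_∈?_)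
  open Encoding _≟ᵛ_ vertex index index-vertex using (sumF-∈)

  adjacent : Fin nV → Fin nV → Bool
  adjacent u v = does (vertex v ∈? nbrs (vertex u))

  adjacent⇒∈ : ∀ {u v} → T (adjacent u v) → vertex v ∈ nbrs (vertex u)
  adjacent⇒∈ {u} {v} = does-witness (vertex v ∈? nbrs (vertex u))

  ∈⇒adjacent : ∀ {u v} → vertex v ∈ nbrs (vertex u) → T (adjacent u v)
  ∈⇒adjacent {u} {v} v∈ = subst T (sym (dec-true (vertex v ∈? nbrs (vertex u)) v∈)) _

  G : Graph nV
  G = record
    { adj   = adjacent
    ; sym   = λ u v → does-⇔ (mk⇔ (nbrs-symmetric (vertex-valid u)) (nbrs-symmetric (vertex-valid v))) (vertex v ∈? nbrs (vertex u)) (vertex u ∈? nbrs (vertex v))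
    ; irref = λ v → dec-false (vertex v ∈? nbrs (vertex v)) (nbrs-loopless (vertex-valid v))
    }

  infix 4 _~ᴳ_
  _~ᴳ_ : Fin nV → Fin nV → Set
  _~ᴳ_ = _~_ G

  index-valid : ∀ {x y} → Valid x → y ∈ nbrs x → vertex (index y) ≡ y
  index-valid valid y∈ = vertex-index (All.lookup (nbrs-valid valid) y∈)

  ∈⇒~ : ∀ {x y} → Valid x → y ∈ nbrs x → index x ~ᴳ index y
  ∈⇒~ {x} {y} valid y∈ = ∈⇒adjacent {index x} {index y}
    (subst₂ (λ a b → a ∈ nbrs b) (sym (index-valid valid y∈)) (sym (vertex-index valid)) y∈)

  vertex-injective : ∀ {u v} → vertex u ≡ vertex v → u ≡ v
  vertex-injective {u} {v} eq = trans (sym (index-vertex u)) (trans (cong index eq) (index-vertex v))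

  σᴳ : Fin nV → Fin nV → Fin nV
  σᴳ v u = index (rot (vertex v) (vertex u))

  vertex-σ : ∀ {v u} → v ~ᴳ u → vertex (σᴳ v u) ≡ rot (vertex v) (vertex u)
  vertex-σ {v} {u} v~u = index-valid (vertex-valid v) (rot-∈ (vertex-valid v) (adjacent⇒∈ {v} {u} v~u))

  σ-adjacent : ∀ {v u} → v ~ᴳ u → v ~ᴳ σᴳ v u
  σ-adjacent {v} {u} v~u = ∈⇒adjacent {v} {σᴳ v u}
    (subst (_∈ nbrs (vertex v)) (sym (vertex-σ {v} {u} v~u)) (rot-∈ (vertex-valid v) (adjacent⇒∈ {v} {u} v~u)))

  iter-σ : ∀ {v u} → v ~ᴳ u → ∀ k → v ~ᴳ iter k (σᴳ v) u × vertex (iter k (σᴳ v) u) ≡ iter k (rot (vertex v)) (vertex u)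
  iter-σ v~u zero    = v~u , refl
  iter-σ {v} {u} v~u (suc k) =
    let v~w , eq = iter-σ {v} {u} v~u k
    in σ-adjacent {v} {iter k (σᴳ v) u} v~w , trans (vertex-σ {v} {iter k (σᴳ v) u} v~w) (cong (rot (vertex v)) eq)

  R : Rotation G
  R = record
    { σ      = σᴳ
    ; closed = λ v u v~u → σ-adjacent {v} {u} v~u
    ; inj    = λ v u w v~u v~w eq → vertex-injective (rot-injective (vertex-valid v) (adjacent⇒∈ {v} {u} v~u) (adjacent⇒∈ {v} {w} v~w)
                 (trans (sym (vertex-σ {v} {u} v~u)) (trans (cong vertex eq) (vertex-σ {v} {w} v~w))))
    ; cyclic = λ v u w v~u v~w → let k , eq = rot-connected (vertex-valid v) (adjacent⇒∈ {v} {u} v~u) (adjacent⇒∈ {v} {w} v~w)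
                 in k , vertex-injective (trans (proj₂ (iter-σ {v} {u} v~u k)) eq)
    }

  open RotationFaces G R using (φ; iter-φ-dart)

  vertex² : Dart nV → Vertex × Vertex
  vertex² (u , v) = vertex u , vertex v

  iter-φ : ∀ {u v} → u ~ᴳ v → ∀ k → vertex² (iter k φ (u , v)) ≡ iter k φV (vertex u , vertex v)
  iter-φ u~v zero    = refl
  iter-φ {u} {v} u~v (suc k) =
    trans (cong (vertex b ,_) (vertex-σ {b} {a} (subst T (Graph.sym G a b) (iter-φ-dart u~v k)))) (cong φV (iter-φ {u} {v} u~v k))
    where
    a = proj₁ (iter k φ (u , v))
    b = proj₂ (iter k φ (u , v))

  quadrilateral : ∀ {u v} → u ~ᴳ v → iter 4 φ (u , v) ≡ (u , v)
  quadrilateral {u} {v} u~v = cong₂ _,_ (vertex-injective (cong proj₁ closes)) (vertex-injective (cong proj₂ closes))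
    where
    closes : vertex² (iter 4 φ (u , v)) ≡ (vertex u , vertex v)
    closes = trans (iter-φ {u} {v} u~v 4) (face-quadrangle (vertex-valid u) (adjacent⇒∈ {u} {v} u~v))

  σ-fixed-point-free : ∀ v u → v ~ᴳ u → σᴳ v u ≢ u
  σ-fixed-point-free v u v~u eq = rot-fixed-point-free (vertex-valid v) (adjacent⇒∈ {v} {u} v~u)
    (trans (sym (vertex-σ {v} {u} v~u)) (cong vertex eq))

  σ-permutes : ∀ v (g : Fin nV → ℕ) → sumF (λ u → indicator (adjacent v u) * g (σᴳ v u)) ≡ sumF (λ u → indicator (adjacent v u) * g u)
  σ-permutes v g = begin
    sumF (λ u → indicator (adjacent v u) * g (σᴳ v u))  ≡⟨ sumF-∈ (nbrs x) (nbrs-unique valid) (index-valid valid) (g ∘ σᴳ v) ⟩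
    sum (map (g ∘ σᴳ v ∘ index) (nbrs x))                ≡⟨ sum-map-cong (nbrs x) (λ y∈ → cong (g ∘ index ∘ rot x) (index-valid valid y∈)) ⟩
    sum (map (g ∘ index ∘ rot x) (nbrs x))               ≡⟨ sum-map-rot valid (g ∘ index) ⟩
    sum (map (g ∘ index) (nbrs x))                       ≡⟨ sumF-∈ (nbrs x) (nbrs-unique valid) (index-valid valid) g ⟨
    sumF (λ u → indicator (adjacent v u) * g u)          ∎
    where
    open ≡-Reasoning
    x = vertex v
    valid = vertex-valid v

  atStart : ℕ → ℕ
  atStart zero    = 1
  atStart (suc _) = 0

  defect : Vertex → ℕ
  defect source              = 1
  defect sink                = 1
  defect (node i _ inner _)  = atStart i
  defect (node _ _ centre _) = 0
  defect (node _ j outer _)  = atStart j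

  length+defect : ∀ {x} → Valid x → length (nbrs x) + defect x ≡ 4
  length+defect {source}                 _ = refl
  length+defect {sink}                   _ = refl
  length+defect {node _ _ centre _}      _ = refl
  length+defect {node zero _ inner _}    _ = refl
  length+defect {node (suc _) _ inner _} _ = refl
  length+defect {node _ zero outer _}    _ = refl
  length+defect {node _ (suc _) outer _} _ = refl

  degree-vertex : ∀ u → degree G u ≡ length (nbrs (vertex u))
  degree-vertex u = begin
    count (adjacent u)                                        ≡⟨ count-sumF (adjacent u) ⟩
    sumF (indicator ∘ adjacent u)                             ≡⟨ sumF-cong {nV} (λ v → *-identityʳ (indicator (adjacent u v))) ⟨
    sumF (λ v → indicator (adjacent u v) * 1)                 ≡⟨ sumF-∈ (nbrs x) (nbrs-unique valid) (index-valid valid) (λ _ → 1) ⟩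
    sum (map (λ _ → 1) (nbrs x))                              ≡⟨ sum-map-1 (nbrs x) ⟩
    length (nbrs x)                                           ∎
    where
    open ≡-Reasoning
    x = vertex u
    valid = vertex-valid u

  block-defect : ∀ i j → sumF (λ p → defect (blockNode i j p)) ≡ 3 * atStart i + 3 * atStart j
  block-defect zero    zero    = refl
  block-defect zero    (suc _) = refl
  block-defect (suc _) zero    = refl
  block-defect (suc _) (suc _) = refl

  sumF-atStart-first : ∀ m → sumF {suc m} (λ b → atStart (toℕ b)) ≡ 1
  sumF-atStart-first m = cong suc (sumF-0 m)

  sumF-atStart-last : ∀ M → sumF {suc M} (λ b → atStart (M ∸ toℕ b)) ≡ 1
  sumF-atStart-last zero    = refl
  sumF-atStart-last (suc M) = sumF-atStart-last M

  sumF-defect : sumF (defect ∘ vertex) ≡ 8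
  sumF-defect = cong (2 +_) (begin
    sumF (λ w → defect (nodeAt (blockOf w)))
      ≡⟨ sumF-combine blocks 9 (λ w → defect (nodeAt (blockOf w))) ⟩
    Σᵇ (λ b → Σ⁹ (λ p → defect (nodeAt (blockOf (combine b p)))))
      ≡⟨ sumF-cong (λ b → sumF-cong (λ p → cong (defect ∘ nodeAt) (remQuot-combine b p))) ⟩
    Σᵇ (λ b → Σ⁹ (λ p → defect (nodeAt (b , p))))
      ≡⟨ sumF-cong {blocks} (λ b → block-defect (toℕ b) (suc N ∸ toℕ b)) ⟩
    Σᵇ (λ b → 3 * atStart (toℕ b) + 3 * atStart (suc N ∸ toℕ b))
      ≡⟨ sumF-+ {blocks} (λ b → 3 * atStart (toℕ b)) (λ b → 3 * atStart (suc N ∸ toℕ b)) ⟩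
    Σᵇ (λ b → 3 * atStart (toℕ b)) + Σᵇ (λ b → 3 * atStart (suc N ∸ toℕ b))
      ≡⟨ cong₂ _+_ (sym (*-sumF {blocks} 3 (λ b → atStart (toℕ b)))) (sym (*-sumF {blocks} 3 (λ b → atStart (suc N ∸ toℕ b)))) ⟩
    3 * Σᵇ (λ b → atStart (toℕ b)) + 3 * Σᵇ (λ b → atStart (suc N ∸ toℕ b))
      ≡⟨ cong₂ (λ a b → 3 * a + 3 * b) (sumF-atStart-first (suc N)) (sumF-atStart-last (suc N)) ⟩
    6 ∎)
    where
    open ≡-Reasoning
    Σᵇ : (Fin blocks → ℕ) → ℕ
    Σᵇ = sumF
    Σ⁹ : (Fin 9 → ℕ) → ℕ
    Σ⁹ = sumF

  numDarts+8 : numDarts G + 8 ≡ 4 * nV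
  numDarts+8 = begin
    sumF (degree G) + 8                                   ≡⟨ cong₂ _+_ (sumF-cong degree-vertex) (sym sumF-defect) ⟩
    sumF (length ∘ nbrs ∘ vertex) + sumF (defect ∘ vertex) ≡⟨ sumF-+ (length ∘ nbrs ∘ vertex) (defect ∘ vertex) ⟨
    sumF (λ u → length (nbrs (vertex u)) + defect (vertex u)) ≡⟨ sumF-cong (λ u → length+defect (vertex-valid u)) ⟩
    sumF {nV} (λ _ → 4)                                   ≡⟨ sumF-const nV 4 ⟩
    nV * 4                                                ≡⟨ *-comm nV 4 ⟩
    4 * nV                                                ∎
    where open ≡-Reasoning

  max-degree : MaxDegree G 4
  max-degree = (λ u → subst (_≤ 4) (sym (degree-vertex u)) (m+n≤o⇒m≤o _ (≤-reflexive (length+defect (vertex-valid u)))))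
             , index hub , trans (degree-vertex (index hub)) (cong (length ∘ nbrs) (vertex-index {hub} refl))
    where
    hub = node 0 (suc N) centre 0F

  planar : Planar G
  planar = Quadrangular.planar σ-fixed-point-free σ-permutes quadrilateral 8≤nV² numDarts+8
    where
    open RotationFaces G R using (module Quadrangular)
    8≤nV² : 8 ≤ nV * nV
    8≤nV² = ≤-trans (s≤s (s≤s (s≤s (s≤s (s≤s (s≤s (s≤s (s≤s z≤n)))))))) (m≤m*n nV nV)

  parity : ℕ → Bool
  parity zero    = true
  parity (suc i) = not (parity i)

  side : Vertex → Bool
  side source              = true
  side sink                = not (side (node (suc N) 0 outer 0F))
  side (node i _ centre _) = parity i
  side (node i _ inner _)  = not (parity i)
  side (node i _ outer _)  = not (parity i)

  -- Stated both ways round because not (not b) does not reduce to b for a variable b.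
  Alternate : Vertex → Vertex → Set
  Alternate x y = side y ≡ not (side x) ⊎ side x ≡ not (side y)

  alternating : ∀ {x} → Valid x → All (Alternate x) (nbrs x)
  alternating {source}                 _ = inj₁ refl ∷ inj₁ refl ∷ inj₁ refl ∷ []
  alternating {sink}                   _ = inj₂ refl ∷ inj₂ refl ∷ inj₂ refl ∷ []
  alternating {node _ _ centre _}      _ = inj₁ refl ∷ inj₁ refl ∷ inj₁ refl ∷ inj₁ refl ∷ []
  alternating {node zero _ inner _}    _ = inj₁ refl ∷ inj₁ refl ∷ inj₁ refl ∷ []
  alternating {node (suc _) _ inner _} _ = inj₂ refl ∷ inj₂ refl ∷ inj₂ refl ∷ inj₂ refl ∷ []
  alternating {node _ (suc _) outer _} _ = inj₂ refl ∷ inj₂ refl ∷ inj₁ refl ∷ inj₁ refl ∷ []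
  alternating {node i zero outer _}    v with block i zero v
  ... | final = inj₂ refl ∷ inj₂ refl ∷ inj₁ refl ∷ []

  side-alternates : ∀ {u v} → u ~ᴳ v → side (vertex v) ≡ not (side (vertex u))
  side-alternates {u} {v} u~v with All.lookup (alternating (vertex-valid u)) (adjacent⇒∈ {u} {v} u~v)
  ... | inj₁ flipped = flipped
  ... | inj₂ flipped = trans (sym (not-involutive _)) (cong not (sym flipped))

  square : Fin 4 → Vertex
  square 0F = node 0 (suc N) centre 0F
  square 1F = node 0 (suc N) inner 0F
  square 2F = node 0 (suc N) centre 1F
  square 3F = node 0 (suc N) outer 0F

  has-square : HasCycle G 4
  has-square = s≤s (s≤s (s≤s z≤n)) , index ∘ square , injective , closed-walk
    where
    injective : ∀ s t → index (square s) ≡ index (square t) → s ≡ t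
    injective = toWitness {a? = all? λ s → all? λ t → index (square s) Fin.≟ index (square t) →-dec s Fin.≟ t} _
    closed-walk : ∀ s → index (square s) ~ᴳ index (square (next s))
    closed-walk 0F = ∈⇒~ {square 0F} refl (here refl)
    closed-walk 1F = ∈⇒~ {square 1F} refl (there (here refl))
    closed-walk 2F = ∈⇒~ {square 2F} refl (there (there (here refl)))
    closed-walk 3F = ∈⇒~ {square 3F} refl (there (here refl))

  girth : Girth G 4
  girth = girth-four G (triangle-free G (side ∘ vertex) (λ {u} {v} → side-alternates {u} {v})) has-square

  cycle4 : ℕ → Fin 4
  cycle4 zero    = 0F
  cycle4 (suc i) = next (cycle4 i)

  -- A colour is a bit and a residue. Along the chain the bits of the three layers repeat with
  -- period 4, arranged so that the two rows of residues around any vertex get different bits.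
  bit : Layer → Fin 4 → Fin 2
  bit centre 0F = 1F
  bit centre 1F = 0F
  bit centre 2F = 0F
  bit centre 3F = 1F
  bit inner  0F = 0F
  bit inner  1F = 0F
  bit inner  2F = 1F
  bit inner  3F = 1F
  bit outer  0F = 1F
  bit outer  1F = 1F
  bit outer  2F = 0F
  bit outer  3F = 0F

  flip : Fin 2 → Fin 2
  flip 0F = 1F
  flip 1F = 0F

  paint : Fin 2 → Fin 3 → Fin 6
  paint = combine

  colour : Vertex → Fin 6
  colour source         = paint 0F 0F
  colour sink           = paint (flip (bit centre (cycle4 (suc N)))) 0F
  colour (node i _ l k) = paint (bit l (cycle4 i)) k

  by-evaluation : (L : Fin 4 → Fin 3 → List (Fin 6)) →
                  {_ : True (all? λ r → all? λ k → unique? (L r k))} → ∀ r k → Unique (L r k)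
  by-evaluation L {all-unique} = toWitness all-unique

  colours-unique : ∀ {x} → Valid x → Unique (map colour (nbrs x))
  colours-unique {source} _ = toWitness {a? = unique? (map colour (nbrs source))} _
  colours-unique {sink} _ = by-evaluation
    (λ r _ → paint (bit outer r) 0F ∷ paint (bit outer r) 2F ∷ paint (bit outer r) 1F ∷ [])
    (cycle4 (suc N)) 0F
  colours-unique {node i _ centre k} _ = by-evaluation
    (λ r k → paint (bit inner r) k ∷ paint (bit inner r) (prev k)
           ∷ paint (bit outer r) (prev k) ∷ paint (bit outer r) k ∷ [])
    (cycle4 i) k
  colours-unique {node zero _ inner k} _ = by-evaluation
    (λ _ k → paint (bit centre 0F) k ∷ paint (bit centre 0F) (next k) ∷ paint 0F 0F ∷ [])
    0F k
  colours-unique {node (suc i) _ inner k} _ = by-evaluation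
    (λ r k → paint (bit centre (next r)) k ∷ paint (bit centre (next r)) (next k)
           ∷ paint (bit outer r) (next k) ∷ paint (bit outer r) k ∷ [])
    (cycle4 i) k
  colours-unique {node i zero outer k} v with block i zero v
  ... | final = by-evaluation
    (λ r k → paint (bit centre r) (next k) ∷ paint (bit centre r) k ∷ paint (flip (bit centre r)) 0F ∷ [])
    (cycle4 (suc N)) k
  colours-unique {node i (suc _) outer k} _ = by-evaluation
    (λ r k → paint (bit centre r) (next k) ∷ paint (bit centre r) k
           ∷ paint (bit inner (next r)) (prev k) ∷ paint (bit inner (next r)) k ∷ [])
    (cycle4 i) k

  colouring : InjectiveColouring G 6 (colour ∘ vertex)
  colouring u v w u≢v u~w v~w = unique-map-≢ colour (colours-unique (vertex-valid w))
    (adjacent⇒∈ {w} {u} (subst T (Graph.sym G u w) u~w)) (adjacent⇒∈ {w} {v} (subst T (Graph.sym G v w) v~w))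
    (λ eq → u≢v (vertex-injective eq))

  rimResidue : Fin 6 → Fin 3
  rimResidue s = proj₂ (remQuot {2} 3 s)

  rim : Fin 6 → Vertex
  rim s = node 0 (suc N) (rimLayer (proj₁ (remQuot {2} 3 s))) (rimResidue s)
    where
    rimLayer : Fin 2 → Layer
    rimLayer 0F = inner
    rimLayer 1F = outer

  centre₀ : Fin 3 → Vertex
  centre₀ = node 0 (suc N) centre

  -- The inner and outer vertex of residue k are both adjacent to the centres of residues k and
  -- k + 1, and any two residues modulo 3 have such a centre in common.
  Sees : Fin 3 → Fin 3 → Set
  Sees c k = c ≡ k ⊎ c ≡ next k

  rim-sees : ∀ s c → Sees c (rimResidue s) → rim s ∈ nbrs (centre₀ c)
  rim-sees 0F _ (inj₁ refl) = here refl
  rim-sees 1F _ (inj₁ refl) = here refl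
  rim-sees 2F _ (inj₁ refl) = here refl
  rim-sees 3F _ (inj₁ refl) = there (there (there (here refl)))
  rim-sees 4F _ (inj₁ refl) = there (there (there (here refl)))
  rim-sees 5F _ (inj₁ refl) = there (there (there (here refl)))
  rim-sees 0F _ (inj₂ refl) = there (here refl)
  rim-sees 1F _ (inj₂ refl) = there (here refl)
  rim-sees 2F _ (inj₂ refl) = there (here refl)
  rim-sees 3F _ (inj₂ refl) = there (there (here refl))
  rim-sees 4F _ (inj₂ refl) = there (there (here refl))
  rim-sees 5F _ (inj₂ refl) = there (there (here refl))

  common-centre : ∀ s t → ∃ λ c → Sees c (rimResidue s) × Sees c (rimResidue t)
  common-centre = toWitness {a? = all? λ s → all? λ t → any? λ c → sees? c (rimResidue s) ×-dec sees? c (rimResidue t)} _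
    where
    sees? : ∀ c k → Dec (Sees c k)
    sees? c k = c Fin.≟ k ⊎-dec c Fin.≟ next k

  rim-distinct : ∀ s t → s Fin.< t → index (rim s) ≢ index (rim t)
  rim-distinct = toWitness {a? = all? λ s → all? λ t → s Fin.<? t →-dec ¬? (index (rim s) Fin.≟ index (rim t))} _

  injective-chromatic : InjChromatic G 6
  injective-chromatic = (colour ∘ vertex , colouring) , injective-colouring-bound G (index ∘ rim) clash
    where
    clash : ∀ {s t} → s Fin.< t → index (rim s) ≢ index (rim t) × ∃ λ w → index (rim s) ~ᴳ w × index (rim t) ~ᴳ w
    clash {s} {t} s<t with common-centre s t
    ... | c , s-sees , t-sees = rim-distinct s t s<t , index (centre₀ c) , sees s s-sees , sees t t-sees
      where
      sees : ∀ r → Sees c (rimResidue r) → index (rim r) ~ᴳ index (centre₀ c)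
      sees r r-sees = subst T (Graph.sym G (index (centre₀ c)) (index (rim r))) (∈⇒~ {centre₀ c} refl (rim-sees r c r-sees))

  next≢ : ∀ k → next k ≢ k
  next≢ = toWitness {a? = all? λ (k : Fin 3) → ¬? (next k Fin.≟ k)} _

  prev≢ : ∀ k → prev k ≢ k
  prev≢ = toWitness {a? = all? λ k → ¬? (prev k Fin.≟ k)} _

  residue : Layer → Fin 3 → Fin 3
  residue centre k = next k
  residue _      k = k

  -- Track k runs inner k, centre (k + 1), outer k through every block, from source to sink.
  trackAt : Fin 3 → ℕ × Layer → Vertex
  trackAt k (i , r) = node i (suc N ∸ i) r (residue r k)

  advance : ℕ × Layer → ℕ × Layer
  advance (i , 0F) = i , 1F
  advance (i , 1F) = i , 2F
  advance (i , 2F) = suc i , 0F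

  place : ℕ → ℕ × Layer
  place zero    = 0 , 0F
  place (suc p) = advance (place p)

  position : ℕ × Layer → ℕ
  position (i , r) = i * 3 + toℕ r

  track : Fin 3 → ℕ → Vertex
  track k p = trackAt k (place p)

  last : ℕ
  last = position (suc N , 2F)

  position-place : ∀ p → position (place p) ≡ p
  position-place zero    = refl
  position-place (suc p) = trans (position-advance (place p)) (cong suc (position-place p))
    where
    position-advance : ∀ x → position (advance x) ≡ suc (position x)
    position-advance (i , 0F) = +-suc (i * 3) 0
    position-advance (i , 1F) = +-suc (i * 3) 1
    position-advance (i , 2F) = trans (+-identityʳ (3 + i * 3)) (cong suc (+-comm 2 (i * 3)))

  place-position : ∀ x → place (position x) ≡ x
  place-position (zero  , 0F) = refl
  place-position (zero  , 1F) = refl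
  place-position (zero  , 2F) = refl
  place-position (suc i , r)  = trans (cong (advance ∘ advance ∘ advance) (place-position (i , r))) (advance³ r)
    where
    advance³ : ∀ r → advance (advance (advance (i , r))) ≡ (suc i , r)
    advance³ 0F = refl
    advance³ 1F = refl
    advance³ 2F = refl

  *3-≤ : ∀ i n → i * 3 ≤ n * 3 + 2 → i ≤ n
  *3-≤ zero    n       _                          = z≤n
  *3-≤ (suc i) zero    (s≤s (s≤s ()))
  *3-≤ (suc i) (suc n) (s≤s (s≤s (s≤s i*3≤n*3+2))) = s≤s (*3-≤ i n i*3≤n*3+2)

  place-bound : ∀ {p} → p ≤ last → proj₁ (place p) ≤ suc N
  place-bound {p} p≤last = *3-≤ _ (suc N) (≤-trans (m≤m+n _ _) (subst (_≤ last) (sym (position-place p)) p≤last))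

  position-bound : ∀ {i} r → i ≤ suc N → position (i , r) ≤ last
  position-bound r i≤ = +-mono-≤ (*-monoˡ-≤ 3 i≤) (toℕ≤pred[n] r)

  track-valid : ∀ k {p} → p ≤ last → Valid (track k p)
  track-valid _ p≤last = m+[n∸m]≡n (place-bound p≤last)

  suc-∸ : ∀ {i} → i ≤ N → suc N ∸ i ≡ suc (N ∸ i)
  suc-∸ = +-∸-assoc 1

  advance-step : ∀ k i r → (r ≡ 2F → i ≤ N) → trackAt k (advance (i , r)) ∈ nbrs (trackAt k (i , r))
  advance-step k  i 0F _   = there (here refl)
  advance-step 0F i 1F _   = there (there (here refl))
  advance-step 1F i 1F _   = there (there (here refl))
  advance-step 2F i 1F _   = there (there (here refl))
  advance-step k  i 2F i≤N rewrite suc-∸ (i≤N refl) = there (there (there (here refl)))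

  track-step : ∀ k {p} → suc p ≤ last → track k (suc p) ∈ nbrs (track k p)
  track-step k {p} p<last = advance-step k (proj₁ (place p)) (proj₂ (place p)) not-last
    where
    not-last : proj₂ (place p) ≡ 2F → proj₁ (place p) ≤ N
    not-last r≡2 = s≤s⁻¹ (*3-≤ (suc (proj₁ (place p))) (suc N) (begin
      suc (proj₁ (place p)) * 3          ≡⟨ cong suc (+-comm 2 _) ⟩
      suc (position (proj₁ (place p) , 2F)) ≡⟨ cong (λ r → suc (position (proj₁ (place p) , r))) (sym r≡2) ⟩
      suc (position (place p))           ≡⟨ cong suc (position-place p) ⟩
      suc p                              ≤⟨ p<last ⟩
      last                               ∎))
      where open ≤-Reasoning

  track-last : ∀ k → track k last ≡ node (suc N) 0 outer k
  track-last k = trans (cong (trackAt k) (place-position (suc N , 2F))) (cong (λ j → node (suc N) j outer k) (n∸n≡0 (suc N)))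

  source-step : ∀ k → track k 0 ∈ nbrs source
  source-step 0F = here refl
  source-step 1F = there (here refl)
  source-step 2F = there (there (here refl))

  sink-step : ∀ k → track k last ∈ nbrs sink
  sink-step k = subst (_∈ nbrs sink) (sym (track-last k)) (on-sink k)
    where
    on-sink : ∀ k → node (suc N) 0 outer k ∈ nbrs sink
    on-sink 0F = here refl
    on-sink 1F = there (there (here refl))
    on-sink 2F = there (here refl)

  track-injective : ∀ {k k′ p p′} → track k p ≡ track k′ p′ → k ≡ k′ × p ≡ p′
  track-injective {k} {k′} {p} {p′} eq with place p in at-p | place p′ in at-p′
  ... | i , r | i′ , r′ with node-injective eq
  ...   | refl , _ , refl , same-residue = same-track r same-residue , (begin
    p                    ≡⟨ position-place p ⟨
    position (place p)   ≡⟨ cong position at-p ⟩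
    position (i , r)     ≡⟨ cong position at-p′ ⟨
    position (place p′)  ≡⟨ position-place p′ ⟩
    p′                   ∎)
    where
    open ≡-Reasoning
    same-track : ∀ r {k k′} → residue r k ≡ residue r k′ → k ≡ k′
    same-track 0F eq = eq
    same-track 1F eq = trans (sym (prev-next _)) (trans (cong prev eq) (prev-next _))
    same-track 2F eq = eq

  locate : ∀ {x} → Valid x → x ≡ source ⊎ x ≡ sink ⊎ ∃₂ λ k p → p ≤ last × x ≡ track k p
  locate {source}       _ = inj₁ refl
  locate {sink}         _ = inj₂ (inj₁ refl)
  locate {node i j l k} v = inj₂ (inj₂ (trackOf l k , position (i , l) , position-bound l i≤ , (begin
    node i j l k                            ≡⟨ cong₂ (λ j′ k′ → node i j′ l k′) (sym j≡) (sym (residue-trackOf l k)) ⟩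
    trackAt (trackOf l k) (i , l)           ≡⟨ cong (trackAt (trackOf l k)) (place-position (i , l)) ⟨
    track (trackOf l k) (position (i , l))  ∎)))
    where
    open ≡-Reasoning
    i≤ : i ≤ suc N
    i≤ = subst (i ≤_) v (m≤m+n i j)
    j≡ : suc N ∸ i ≡ j
    j≡ = trans (cong (_∸ i) (sym v)) (m+n∸m≡n i j)
    trackOf : Layer → Fin 3 → Fin 3
    trackOf centre k = prev k
    trackOf _      k = k
    residue-trackOf : ∀ l k → residue l (trackOf l k) ≡ k
    residue-trackOf 0F k = refl
    residue-trackOf 1F k = next-prev k
    residue-trackOf 2F k = refl

  track-cross : ∀ k i r → ∃₂ λ k′ r′ → k′ ≢ k × trackAt k′ (i , r′) ∈ nbrs (trackAt k (i , r))
  track-cross 0F i 0F = prev 0F , 1F , prev≢ 0F , here refl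
  track-cross 1F i 0F = prev 1F , 1F , prev≢ 1F , here refl
  track-cross 2F i 0F = prev 2F , 1F , prev≢ 2F , here refl
  track-cross k  i 1F = next k  , 0F , next≢ k  , here refl
  track-cross 0F i 2F = prev 0F , 1F , prev≢ 0F , there (here refl)
  track-cross 1F i 2F = prev 1F , 1F , prev≢ 1F , there (here refl)
  track-cross 2F i 2F = prev 2F , 1F , prev≢ 2F , there (here refl)

  cross : ∀ k {p} → p ≤ last → ∃₂ λ k′ p′ → k′ ≢ k × p′ ≤ last × track k′ p′ ∈ nbrs (track k p)
  cross k {p} p≤last with track-cross k (proj₁ (place p)) (proj₂ (place p))
  ... | k′ , r′ , k′≢k , adjacent =
    k′ , position (proj₁ (place p) , r′) , k′≢k , position-bound r′ (place-bound p≤last) ,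
    subst (_∈ nbrs (track k p)) (cong (trackAt k′) (sym (place-position _))) adjacent

  link-next : ∀ k → track (next k) 0 ∈ nbrs (track k 1)
  link-next k = here refl

  link-prev : ∀ k → track (prev k) 1 ∈ nbrs (track k 0)
  link-prev 0F = here refl
  link-prev 1F = here refl
  link-prev 2F = here refl

  neighbouring-tracks : ∀ {k k′} → k′ ≢ k → k′ ≡ next k ⊎ k′ ≡ prev k
  neighbouring-tracks {k} {k′} = toWitness {a? = all? λ k → all? λ k′ → ¬? (k′ Fin.≟ k) →-dec (k′ Fin.≟ next k ⊎-dec k′ Fin.≟ prev k)} _ k k′

  third-track : ∀ ka kb → ∃ λ (k : Fin 3) → k ≢ ka × k ≢ kb
  third-track = toWitness {a? = all? λ ka → all? λ kb → any? λ k → ¬? (k Fin.≟ ka) ×-dec ¬? (k Fin.≟ kb)} _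

  module Avoiding (a b : Fin nV) where

    Allowed : Vertex → Set
    Allowed y = y ≢ vertex a × y ≢ vertex b

    Open : Fin nV → Set
    Open w = w ≢ a × w ≢ b

    infix 4 _⇝_
    record _⇝_ (x y : Vertex) : Set where
      constructor walk
      field reach : Reach G Open (index x) (index y)
    open _⇝_

    open-index : ∀ {y} → Valid y → Allowed y → Open (index y)
    open-index valid (≢a , ≢b) = (λ eq → ≢a (trans (sym (vertex-index valid)) (cong vertex eq)))
                               , (λ eq → ≢b (trans (sym (vertex-index valid)) (cong vertex eq)))

    ⇝-refl : ∀ {x} → x ⇝ x
    ⇝-refl = walk here

    ⇝-step : ∀ {x y z} → Valid x → y ∈ nbrs x → Allowed y → y ⇝ z → x ⇝ z
    ⇝-step valid y∈ allowed (walk y⇝z) = walk (step (∈⇒~ valid y∈) (open-index (All.lookup (nbrs-valid valid) y∈) allowed) y⇝z)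

    ⇝-trans : ∀ {x y z} → x ⇝ y → y ⇝ z → x ⇝ z
    ⇝-trans (walk x⇝y) (walk y⇝z) = walk (reach-trans G x⇝y y⇝z)

    ⇝-sym : ∀ {x y} → Valid x → Allowed x → x ⇝ y → y ⇝ x
    ⇝-sym valid allowed (walk x⇝y) = walk (reach-sym G (open-index valid allowed) x⇝y)

    walk-down : ∀ k {p} → p ≤ last → (∀ q → q < p → Allowed (track k q)) → track k p ⇝ track k 0
    walk-down k {zero}  _       _       = ⇝-refl
    walk-down k {suc p} p<last allowed =
      ⇝-step (track-valid k p<last) (nbrs-symmetric (track-valid k (<⇒≤ p<last)) (track-step k p<last))
             (allowed p ≤-refl)
             (walk-down k (<⇒≤ p<last) (λ q q<p → allowed q (m≤n⇒m≤1+n q<p)))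

    walk-up : ∀ k {p} d → p + d ≡ last → (∀ q → p < q → q ≤ last → Allowed (track k q)) → track k p ⇝ track k last
    walk-up k {p} zero    p+0≡last _       = subst (λ q → track k p ⇝ track k q) (trans (sym (+-identityʳ p)) p+0≡last) ⇝-refl
    walk-up k {p} (suc d) p+d≡last allowed =
      ⇝-step (track-valid k (<⇒≤ p<last)) (track-step k p<last) (allowed (suc p) ≤-refl p<last)
             (walk-up k d (trans (sym (+-suc p d)) p+d≡last) (λ q p<q q≤ → allowed q (<⇒≤ p<q) q≤))
      where
      p<last : suc p ≤ last
      p<last = subst (suc p ≤_) p+d≡last (≤-trans (s≤s (m≤m+n p d)) (≤-reflexive (sym (+-suc p d))))

    Clean : Fin 3 → Set
    Clean k = ∀ q → Allowed (track k q)

    along : ∀ {k p q} → Clean k → p ≤ last → q ≤ last → track k p ⇝ track k q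
    along {k} {p} {q} clean p≤ q≤ = ⇝-trans (walk-down k p≤ (λ r _ → clean r))
      (⇝-sym (track-valid k q≤) (clean q) (walk-down k q≤ (λ r _ → clean r)))

    -- Each removed vertex lies on at most one track, so one of the three tracks survives.
    on-one-track : ∀ {y} → Valid y → ∃ λ k → ∀ k′ → k′ ≢ k → ∀ q → track k′ q ≢ y
    on-one-track valid with locate valid
    ... | inj₁ refl                      = 0F , λ _ _ _ ()
    ... | inj₂ (inj₁ refl)               = 0F , λ _ _ _ ()
    ... | inj₂ (inj₂ (k , p , _ , refl)) = k , λ k′ k′≢k q eq → k′≢k (proj₁ (track-injective {k′} {k} {q} {p} eq))

    clean-track : ∃ Clean
    clean-track with on-one-track (vertex-valid a) | on-one-track (vertex-valid b)
    ... | ka , off-a | kb , off-b with third-track ka kb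
    ...   | k , k≢ka , k≢kb = k , λ q → off-a k k≢ka q , off-b k k≢kb q

    kᶜ : Fin 3
    kᶜ = proj₁ clean-track

    hub : Vertex
    hub = track kᶜ 0

    clean-linked : ∀ {k k′ p} → Clean k → Clean k′ → p ≤ last → track k p ⇝ track k′ 0
    clean-linked {k} {k′} clean clean′ p≤ with k′ Fin.≟ k
    ... | yes refl = along clean p≤ z≤n
    ... | no  k′≢k with neighbouring-tracks k′≢k
    ...   | inj₁ refl = ⇝-trans (along clean p≤ (s≤s z≤n))
                          (⇝-step (track-valid k (s≤s z≤n)) (link-next k) (clean′ 0) ⇝-refl)
    ...   | inj₂ refl = ⇝-trans (along clean p≤ z≤n)
                          (⇝-step (track-valid k z≤n) (link-prev k) (clean′ 1) (walk-down k′ (s≤s z≤n) (λ q _ → clean′ q)))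

    Below Above : Fin 3 → ℕ → Vertex → Set
    Below k p y = y ≡ source ⊎ ∃ λ q → q < p × y ≡ track k q
    Above k p y = y ≡ sink   ⊎ ∃ λ q → p < q × y ≡ track k q

    Off : Fin 3 → Vertex → Set
    Off k y = y ≢ source × y ≢ sink × ∀ q → track k q ≢ y

    classify : ∀ {y} k p → Valid y → track k p ≢ y → Below k p y ⊎ Above k p y ⊎ Off k y
    classify k p valid x≢y with locate valid
    ... | inj₁ refl                       = inj₁ (inj₁ refl)
    ... | inj₂ (inj₁ refl)                = inj₂ (inj₁ (inj₁ refl))
    ... | inj₂ (inj₂ (k′ , q , _ , refl)) with k′ Fin.≟ k
    ...   | no  k′≢k = inj₂ (inj₂ ((λ ()) , (λ ()) , λ q′ eq → k′≢k (sym (proj₁ (track-injective {k} {k′} {q′} {q} eq)))))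
    ...   | yes refl with <-cmp q p
    ...     | tri< q<p _ _ = inj₁ (inj₂ (q , q<p , refl))
    ...     | tri≈ _ refl _ = ⊥-elim (x≢y refl)
    ...     | tri> _ _ p<q = inj₂ (inj₁ (inj₂ (q , p<q , refl)))

    clear-below : ∀ {k p y} → Above k p y ⊎ Off k y → y ≢ source × ∀ q → q < p → track k q ≢ y
    clear-below (inj₁ (inj₁ refl))               = (λ ()) , λ _ _ ()
    clear-below (inj₁ (inj₂ (q′ , p<q′ , refl))) = (λ ()) , λ q q<p eq → <-asym q<p (subst (_ <_) (sym (proj₂ (track-injective eq))) p<q′)
    clear-below (inj₂ (≢source , _ , off))       = ≢source , λ q _ → off q

    clear-above : ∀ {k p y} → Below k p y ⊎ Off k y → y ≢ sink × ∀ q → p < q → track k q ≢ y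
    clear-above (inj₁ (inj₁ refl))               = (λ ()) , λ _ _ ()
    clear-above (inj₁ (inj₂ (q′ , q′<p , refl))) = (λ ()) , λ q p<q eq → <-asym q′<p (subst (_ <_) (proj₂ (track-injective eq)) p<q)
    clear-above (inj₂ (_ , ≢sink , off))         = ≢sink , λ q _ → off q

    off-other-tracks : ∀ {k p y} → Below k p y ⊎ Above k p y → ∀ k′ → k′ ≢ k → ∀ q → track k′ q ≢ y
    off-other-tracks (inj₁ (inj₁ refl))          _  _    _ ()
    off-other-tracks {k} (inj₁ (inj₂ (q′ , _ , refl))) k′ k′≢k q eq = k′≢k (proj₁ (track-injective {k′} {k} {q} {q′} eq))
    off-other-tracks (inj₂ (inj₁ refl))          _  _    _ ()
    off-other-tracks {k} (inj₂ (inj₂ (q′ , _ , refl))) k′ k′≢k q eq = k′≢k (proj₁ (track-injective {k′} {k} {q} {q′} eq))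

    source-to-hub : Allowed source → source ⇝ hub
    source-to-hub _ = ⇝-step _ (source-step kᶜ) (proj₂ clean-track 0) ⇝-refl

    sink-to-hub : Allowed sink → sink ⇝ hub
    sink-to-hub _ = ⇝-step _ (sink-step kᶜ) (proj₂ clean-track last) (along (proj₂ clean-track) ≤-refl z≤n)

    via-source : ∀ {k p} → p ≤ last → Above k p (vertex a) ⊎ Off k (vertex a) → Above k p (vertex b) ⊎ Off k (vertex b) → track k p ⇝ hub
    via-source {k} p≤ a-clear b-clear =
      let a≢source , a-below = clear-below a-clear ; b≢source , b-below = clear-below b-clear
      in ⇝-trans (walk-down k p≤ (λ q q<p → a-below q q<p , b-below q q<p))
                 (⇝-step (track-valid k z≤n) (nbrs-symmetric _ (source-step k)) (≢-sym a≢source , ≢-sym b≢source)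
                   (source-to-hub (≢-sym a≢source , ≢-sym b≢source)))

    via-sink : ∀ {k p} → p ≤ last → Below k p (vertex a) ⊎ Off k (vertex a) → Below k p (vertex b) ⊎ Off k (vertex b) → track k p ⇝ hub
    via-sink {k} {p} p≤ a-clear b-clear =
      let a≢sink , a-above = clear-above a-clear ; b≢sink , b-above = clear-above b-clear
      in ⇝-trans (walk-up k (last ∸ p) (m+[n∸m]≡n p≤) (λ q p<q _ → a-above q p<q , b-above q p<q))
                 (⇝-step (track-valid k ≤-refl) (nbrs-symmetric _ (sink-step k)) (≢-sym a≢sink , ≢-sym b≢sink)
                   (sink-to-hub (≢-sym a≢sink , ≢-sym b≢sink)))

    -- Both removed vertices block track k, one on each side, so every other track is clean.
    via-cross : ∀ {k p} → p ≤ last → Below k p (vertex a) ⊎ Above k p (vertex a) → Below k p (vertex b) ⊎ Above k p (vertex b) → track k p ⇝ hub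
    via-cross {k} p≤ a-on b-on with cross k p≤
    ... | k′ , p′ , k′≢k , p′≤ , adjacent =
      ⇝-step (track-valid k p≤) adjacent (clean′ p′) (clean-linked clean′ (proj₂ clean-track) p′≤)
      where
      clean′ : Clean k′
      clean′ q = off-other-tracks a-on k′ k′≢k q , off-other-tracks b-on k′ k′≢k q

    track-to-hub : ∀ {k p} → p ≤ last → Allowed (track k p) → track k p ⇝ hub
    track-to-hub {k} {p} p≤ (≢a , ≢b) with classify k p (vertex-valid a) ≢a | classify k p (vertex-valid b) ≢b
    ... | inj₁ below-a        | inj₂ (inj₁ above-b) = via-cross p≤ (inj₁ below-a) (inj₂ above-b)
    ... | inj₂ (inj₁ above-a) | inj₁ below-b        = via-cross p≤ (inj₂ above-a) (inj₁ below-b)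
    ... | inj₁ below-a        | inj₁ below-b        = via-sink p≤ (inj₁ below-a) (inj₁ below-b)
    ... | inj₁ below-a        | inj₂ (inj₂ off-b)   = via-sink p≤ (inj₁ below-a) (inj₂ off-b)
    ... | inj₂ (inj₂ off-a)   | inj₁ below-b        = via-sink p≤ (inj₂ off-a) (inj₁ below-b)
    ... | inj₂ (inj₁ above-a) | inj₂ (inj₁ above-b) = via-source p≤ (inj₁ above-a) (inj₁ above-b)
    ... | inj₂ (inj₁ above-a) | inj₂ (inj₂ off-b)   = via-source p≤ (inj₁ above-a) (inj₂ off-b)
    ... | inj₂ (inj₂ off-a)   | inj₂ (inj₁ above-b) = via-source p≤ (inj₂ off-a) (inj₁ above-b)
    ... | inj₂ (inj₂ off-a)   | inj₂ (inj₂ off-b)   = via-source p≤ (inj₂ off-a) (inj₂ off-b)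

    to-hub : ∀ {x} → Valid x → Allowed x → x ⇝ hub
    to-hub valid allowed with locate valid
    ... | inj₁ refl                      = source-to-hub allowed
    ... | inj₂ (inj₁ refl)               = sink-to-hub allowed
    ... | inj₂ (inj₂ (k , p , p≤ , refl)) = track-to-hub p≤ allowed

    connected : ∀ u v → Open u → Open v → Reach G Open u v
    connected u v (u≢a , u≢b) (v≢a , v≢b) =
      subst₂ (Reach G Open) (index-vertex u) (index-vertex v)
        (reach (⇝-trans (to-hub (vertex-valid u) (allowed u≢a u≢b))
                        (⇝-sym (vertex-valid v) (allowed v≢a v≢b) (to-hub (vertex-valid v) (allowed v≢a v≢b)))))
      where
      allowed : ∀ {w} → w ≢ a → w ≢ b → Allowed (vertex w)
      allowed w≢a w≢b = (λ eq → w≢a (vertex-injective eq)) , (λ eq → w≢b (vertex-injective eq))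

  three-connected : ThreeConnected G
  three-connected = s≤s (s≤s (s≤s (s≤s z≤n))) , λ a b u v u≢a u≢b v≢a v≢b → Avoiding.connected a b u v (u≢a , u≢b) (v≢a , v≢b)

theorem15 : ∀ (N : ℕ) → Σ ℕ λ n → N < n × Σ (Graph n) λ G →
    ThreeConnected G × Planar G × MaxDegree G 4 × Girth G 4 × InjChromatic G 6
theorem15 N = nV , N<nV , G , three-connected , planar , max-degree , girth , injective-chromatic
  where
  open Construction N
  N<nV : N < nV
  N<nV = s≤s (≤-trans (m≤m*n N 9) (m≤n+m (N * 9) 19))
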